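{- (2-cut with spill) In the linear multirole logic LMRL over a set of roles $\mathcal{R}$, let $R_1,R_2\subseteq\mathcal{R}$ be such that $\mathcal{R}\setminus R_1$ and $\mathcal{R}\setminus R_2$ are disjoint. Then for all sequents $\Gamma_1,\Gamma_2$ and every formula $A$: if $\vdash\Gamma_1,[R_1]A$ and $\vdash\Gamma_2,[R_2]A$ are derivable, then $\vdash\Gamma_1,\Gamma_2,[R_1\cap R_2]A$ is derivable.
   Context: Fix a set $\mathcal{R}$ (the set of roles), possibly infinite. For $R\subseteq\mathcal{R}$ write $\overline{R}=\mathcal{R}\setminus R$; $R_1\uplus\cdots\uplus R_n$ denotes the union of pairwise disjoint sets. A filter on $\mathcal{R}$ is a set $\mathcal{F}$ of subsets of $\mathcal{R}$ with $\mathcal{R}\in\mathcal{F}$, upward closed under inclusion, and closed under binary intersection; an ultrafilter $\mathcal{U}$ is a filter such that for every $R\subseteq\mathcal{R}$, $R\in\mathcal{U}$ or $\overline{R}\in\mathcal{U}$. An endomorphism is any $f:\mathcal{R}\to\mathcal{R}$; $f^{ -1}(R)$ is the preimage. Terms $t$, atomic formulas $a$ are standard first-order. Formulas of LMRL: $A ::= a \mid \neg_f(A) \mid A_1\wedge_{\mathcal{U}}A_2 \mid A\supset_{f,\mathcal{U}}B \mid (!A)_{\mathcal{U}} \mid \forall_{\mathcal{U}}(\lambda x.A)$ ($f$ endomorphism, $\mathcal{U}$ ultrafilter); $A[x:=t]$ is substitution. An i-formula is $[R]A$ with $R\subseteq\mathcal{R}$; a sequent $\Gamma$ is a finite multiset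 of i-formulas, commas denoting multiset union. $?(\Gamma)$ denotes a sequent each of whose i-formulas has the form $[R'](!B)_{\mathcal{U}'}$ with $R'\notin\mathcal{U}'$. Derivable sequents are generated by: (Id) $\vdash[R_1]a,\dots,[R_n]a$ for atomic $a$, $n\ge1$, $R_1\uplus\cdots\uplus R_n=\mathcal{R}$; ($\neg$) from $\vdash\Gamma,[f^{ -1}(R)]A$ infer $\vdash\Gamma,[R]\neg_f(A)$; ($\supset$-neg) if $R\notin\mathcal{U}$, from $\vdash\Gamma,[f^{ -1}(R)]A,[R]B$ infer $\vdash\Gamma,[R](A\supset_{f,\mathcal{U}}B)$; ($\supset$-pos) if $R\in\mathcal{U}$, from $\vdash\Gamma_1,[f^{ -1}(R)]A$ and $\vdash\Gamma_2,[R]B$ infer $\vdash\Gamma_1,\Gamma_2,[R](A\supset_{f,\mathcal{U}}B)$; ($\wedge$-neg) if $R\notin\mathcal{U}$, from $\vdash\Gamma,[R]A$ or from $\vdash\Gamma,[R]B$ infer $\vdash\Gamma,[R](A\wedge_{\mathcal{U}}B)$; ($\wedge$-pos) if $R\in\mathcal{U}$, from $\vdash\Gamma,[R]A$ and $\vdash\Gamma,[R]B$ infer $\vdash\Gamma,[R](A\wedge_{\mathcal{U}}B)$; ($!$-pos) if $R\in\mathcal{U}$, from $\vdash ?(\Gamma),[R]A$ infer $\vdash ?(\Gamma),[R](!A)_{\mathcal{U}}$; ($!$-neg-weaken) if $R\notin\mathcal{U}$, from $\vdash\Gamma$ infer $\vdash\Gamma,[R](!A)_{\mathcal{U}}$;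 ($!$-neg-derelict) if $R\notin\mathcal{U}$, from $\vdash\Gamma,[R]A$ infer $\vdash\Gamma,[R](!A)_{\mathcal{U}}$; ($!$-neg-contract) if $R\notin\mathcal{U}$, from $\vdash\Gamma,[R](!A)_{\mathcal{U}},[R](!A)_{\mathcal{U}}$ infer $\vdash\Gamma,[R](!A)_{\mathcal{U}}$; ($\forall$-neg) if $R\notin\mathcal{U}$, from $\vdash\Gamma,[R]A[x:=t]$ infer $\vdash\Gamma,[R]\forall_{\mathcal{U}}(\lambda x.A)$; ($\forall$-pos) if $R\in\mathcal{U}$ and $x$ not free in $\Gamma$, from $\vdash\Gamma,[R]A$ infer $\vdash\Gamma,[R]\forall_{\mathcal{U}}(\lambda x.A)$. -}

module Defs where

open import Data.Nat using (ℕ; zero; suc)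
open import Data.List using (List; []; _∷_; _++_; map; length; lookup)
open import Data.List.Relation.Unary.All using (All)
open import Data.List.Relation.Binary.Pointwise using (Pointwise)
open import Data.List.Relation.Binary.Permutation.Propositional using (_↭_)
open import Data.Fin using (Fin)
open import Data.Product using (Σ; _×_; _,_)
open import Data.Sum using (_⊎_)
open import Data.Empty using (⊥)
open import Data.Unit using (⊤)
open import Relation.Nullary using (¬_)
open import Relation.Binary.PropositionalEquality using (_≡_; _≢_)

data Term : Set where
  var : ℕ → Term
  fun : ℕ → List Term → Term

data Atom : Set where
  atom : ℕ → List Term → Atom

mutual
  renT : (ℕ → ℕ) → Term → Term
  renT ρ (var x) = var (ρ x)
  renT ρ (fun k ts) = fun k (renTs ρ ts)

  renTs : (ℕ → ℕ) → List Term → List Term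
  renTs ρ [] = []
  renTs ρ (t ∷ ts) = renT ρ t ∷ renTs ρ ts

mutual
  subT : (ℕ → Term) → Term → Term
  subT σ (var x) = σ x
  subT σ (fun k ts) = fun k (subTs σ ts)

  subTs : (ℕ → Term) → List Term → List Term
  subTs σ [] = []
  subTs σ (t ∷ ts) = subT σ t ∷ subTs σ ts

liftRen : (ℕ → ℕ) → ℕ → ℕ
liftRen ρ zero = zero
liftRen ρ (suc n) = suc (ρ n)

liftSub : (ℕ → Term) → ℕ → Term
liftSub σ zero = var zero
liftSub σ (suc n) = renT suc (σ n)

renA : (ℕ → ℕ) → Atom → Atom
renA ρ (atom p ts) = atom p (renTs ρ ts)

subA : (ℕ → Term) → Atom → Atom
subA σ (atom p ts) = atom p (subTs σ ts)

-- σ for A[x:=t] where x is the de Bruijn index 0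
inst : Term → ℕ → Term
inst t zero = t
inst t (suc n) = var n

module LMRL (Role : Set) where

  Subset : Set₁
  Subset = Role → Set

  _∩_ : Subset → Subset → Subset
  (R ∩ S) r = R r × S r

  ∁ : Subset → Subset
  ∁ R r = ¬ R r

  _⁻¹[_] : (Role → Role) → Subset → Subset
  (f ⁻¹[ R ]) r = R (f r)

  _⊆_ : Subset → Subset → Set
  R ⊆ S = ∀ r → R r → S r

  _≐_ : Subset → Subset → Set
  R ≐ S = (R ⊆ S) × (S ⊆ R)

  record Ultrafilter : Set₁ where
    field
      _∈U   : Subset → Set
      full  : (λ _ → ⊤) ∈U
      upw   : ∀ {R S} → R ⊆ S → R ∈U → S ∈U
      inter : ∀ {R S} → R ∈U → S ∈U → (R ∩ S) ∈U
      ultra : ∀ R → R ∈U ⊎ (∁ R) ∈U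
  open Ultrafilter public

  -- formulas; ∀ binds de Bruijn index 0
  data Formula : Set₁ where
    at    : Atom → Formula
    ¬[_]  : (Role → Role) → Formula → Formula
    and   : Ultrafilter → Formula → Formula → Formula
    imp   : (Role → Role) → Ultrafilter → Formula → Formula → Formula
    bang  : Ultrafilter → Formula → Formula
    all   : Ultrafilter → Formula → Formula

  renF : (ℕ → ℕ) → Formula → Formula
  renF ρ (at a) = at (renA ρ a)
  renF ρ (¬[ f ] A) = ¬[ f ] (renF ρ A)
  renF ρ (and U A B) = and U (renF ρ A) (renF ρ B)
  renF ρ (imp f U A B) = imp f U (renF ρ A) (renF ρ B)
  renF ρ (bang U A) = bang U (renF ρ A)
  renF ρ (all U A) = all U (renF (liftRen ρ) A)

  subF : (ℕ → Term) → Formula → Formula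
  subF σ (at a) = at (subA σ a)
  subF σ (¬[ f ] A) = ¬[ f ] (subF σ A)
  subF σ (and U A B) = and U (subF σ A) (subF σ B)
  subF σ (imp f U A B) = imp f U (subF σ A) (subF σ B)
  subF σ (bang U A) = bang U (subF σ A)
  subF σ (all U A) = all U (subF (liftSub σ) A)

  _[0≔_] : Formula → Term → Formula
  A [0≔ t ] = subF (inst t) A

  record IFormula : Set₁ where
    constructor [_]_
    field
      roles : Subset
      form  : Formula

  Sequent : Set₁
  Sequent = List IFormula

  -- shift free variables (used for the eigenvariable condition of ∀-pos)
  ↑ : Sequent → Sequent
  ↑ = map (λ { ([ R ] A) → [ R ] renF suc A })

  _≃_ : IFormula → IFormula → Set₁
  ([ R ] A) ≃ ([ S ] B) = (R ≐ S) × (A ≡ B)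

  Partition : List Subset → Set
  Partition Rs =
    (∀ (r : Role) → Σ (Fin (length Rs)) (λ i → lookup Rs i r)) ×
    (∀ (i j : Fin (length Rs)) → i ≢ j → ∀ r → lookup Rs i r → lookup Rs j r → ⊥)

  WhyNot : IFormula → Set₁
  WhyNot ([ R ] A) = Σ Ultrafilter λ U → Σ Formula λ B → (A ≡ bang U B) × (¬ (U ∈U) R)

  infix 4 ⊢_
  data ⊢_ : Sequent → Set₁ where
    id : ∀ (a : Atom) (R : Subset) (Rs : List Subset) → Partition (R ∷ Rs) →
         ⊢ map (λ S → [ S ] at a) (R ∷ Rs)
    neg : ∀ {Γ R f A} → ⊢ [ f ⁻¹[ R ] ] A ∷ Γ → ⊢ [ R ] ¬[ f ] A ∷ Γ
    imp-neg : ∀ {Γ R f U A B} → ¬ (U ∈U) R →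
         ⊢ [ f ⁻¹[ R ] ] A ∷ [ R ] B ∷ Γ → ⊢ [ R ] imp f U A B ∷ Γ
    imp-pos : ∀ {Γ₁ Γ₂ R f U A B} → (U ∈U) R →
         ⊢ [ f ⁻¹[ R ] ] A ∷ Γ₁ → ⊢ [ R ] B ∷ Γ₂ → ⊢ [ R ] imp f U A B ∷ Γ₁ ++ Γ₂
    and-neg₁ : ∀ {Γ R U A B} → ¬ (U ∈U) R → ⊢ [ R ] A ∷ Γ → ⊢ [ R ] and U A B ∷ Γ
    and-neg₂ : ∀ {Γ R U A B} → ¬ (U ∈U) R → ⊢ [ R ] B ∷ Γ → ⊢ [ R ] and U A B ∷ Γ
    and-pos : ∀ {Γ R U A B} → (U ∈U) R →
         ⊢ [ R ] A ∷ Γ → ⊢ [ R ] B ∷ Γ → ⊢ [ R ] and U A B ∷ Γ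
    bang-pos : ∀ {Γ R U A} → All WhyNot Γ → (U ∈U) R →
         ⊢ [ R ] A ∷ Γ → ⊢ [ R ] bang U A ∷ Γ
    bang-weaken : ∀ {Γ R U A} → ¬ (U ∈U) R → ⊢ Γ → ⊢ [ R ] bang U A ∷ Γ
    bang-derelict : ∀ {Γ R U A} → ¬ (U ∈U) R → ⊢ [ R ] A ∷ Γ → ⊢ [ R ] bang U A ∷ Γ
    bang-contract : ∀ {Γ R U A} → ¬ (U ∈U) R →
         ⊢ [ R ] bang U A ∷ [ R ] bang U A ∷ Γ → ⊢ [ R ] bang U A ∷ Γ
    all-neg : ∀ {Γ R U A} (t : Term) → ¬ (U ∈U) R →
         ⊢ [ R ] (A [0≔ t ]) ∷ Γ → ⊢ [ R ] all U A ∷ Γ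
    all-pos : ∀ {Γ R U A} → (U ∈U) R →
         ⊢ [ R ] A ∷ ↑ Γ → ⊢ [ R ] all U A ∷ Γ
    -- sequents are multisets of i-formulas whose labels are sets
    exchange : ∀ {Γ Δ} → Γ ↭ Δ → ⊢ Γ → ⊢ Δ
    ext : ∀ {Γ Δ} → Pointwise _≃_ Γ Δ → ⊢ Γ → ⊢ Δ

-- Cut admissibility, by induction on the size of the cut formula.  For a fixed size the cut is
-- permuted upwards, first through the left premise and then through the right one, until the cut
-- formula is principal on both sides, where it reduces to cuts on smaller formulas.  Disjointness of
-- the complements of R₁ and R₂ means that an ultrafilter misses at most one of R₁, R₂, so two
-- principal rules of negative polarity never meet, and R₁ ∩ R₂ has the polarity required to rebuild
-- the conclusion.  The one cut that cannot be permuted is a ?-formula [R₁](!B)_U (R₁ ∉ U) sitting in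
-- the context of a promotion; the other side is then a promotion, which is cut against all copies of
-- the ?-formula at once, its own ?-context absorbing the resulting weakenings and contractions.

module Submission where

open import Defs
open import Data.Nat using (ℕ; zero; suc; _+_; _<_; _≤_; s≤s)
open import Data.Nat.Properties using (≤-refl; <-≤-trans; m≤m+n; m≤n+m; +-suc)
open import Data.Fin using (Fin) renaming (zero to fzero; suc to fsuc)
open import Data.Vec using ([]; _∷_)
open import Data.List using (List; []; _∷_; _++_; map; replicate; lookup)
open import Data.List.Properties using (map-++; map-∘; map-replicate; ++-identityʳ)
open import Data.List.Relation.Unary.All as All using (All; []; _∷_)
import Data.List.Relation.Unary.All.Properties as All
open import Data.List.Relation.Unary.Any as Any using (Any; here; there)
import Data.List.Relation.Unary.Any.Properties as Any
open import Data.List.Relation.Unary.AllPairs using (AllPairs; []; _∷_)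
import Data.List.Relation.Unary.AllPairs.Properties as AllPairs
open import Data.List.Relation.Binary.Pointwise using (Pointwise; []; _∷_)
import Data.List.Relation.Binary.Permutation.Propositional as ↭ₚ
import Data.List.Relation.Binary.Permutation.Propositional.Properties as ↭ₚ
import Data.List.Relation.Binary.Permutation.Setoid as PermutationSetoid
import Data.List.Relation.Binary.Permutation.Setoid.Properties as PermutationSetoidProperties
import Data.List.Membership.Setoid.Properties as Membership
open import Data.List.Membership.Propositional using (lose)
open import Data.List.Membership.Propositional.Properties using (∈-lookup)
open import Data.Product using (Σ; _×_; _,_; proj₁; proj₂)
open import Data.Sum using (_⊎_; inj₁; inj₂)
open import Data.Empty using (⊥; ⊥-elim)
open import Function using (_∘_)
open import Level using (0ℓ) renaming (suc to lsuc)
open import Relation.Binary.Bundles using (Setoid)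
open import Relation.Binary.PropositionalEquality
  using (_≡_; _≢_; _≗_; refl; sym; trans; cong; cong₂; subst; subst₂; module ≡-Reasoning)
open import Relation.Nullary using (¬_)

mutual
  subT-cong : ∀ {σ τ} → σ ≗ τ → subT σ ≗ subT τ
  subT-cong σ≗τ (var x)    = σ≗τ x
  subT-cong σ≗τ (fun k ts) = cong (fun k) (subTs-cong σ≗τ ts)

  subTs-cong : ∀ {σ τ} → σ ≗ τ → subTs σ ≗ subTs τ
  subTs-cong σ≗τ []       = refl
  subTs-cong σ≗τ (t ∷ ts) = cong₂ _∷_ (subT-cong σ≗τ t) (subTs-cong σ≗τ ts)

mutual
  renT≡subT : ∀ ρ → renT ρ ≗ subT (var ∘ ρ)
  renT≡subT ρ (var x)    = refl
  renT≡subT ρ (fun k ts) = cong (fun k) (renTs≡subTs ρ ts)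

  renTs≡subTs : ∀ ρ → renTs ρ ≗ subTs (var ∘ ρ)
  renTs≡subTs ρ []       = refl
  renTs≡subTs ρ (t ∷ ts) = cong₂ _∷_ (renT≡subT ρ t) (renTs≡subTs ρ ts)

mutual
  subT-subT : ∀ σ τ → subT σ ∘ subT τ ≗ subT (subT σ ∘ τ)
  subT-subT σ τ (var x)    = refl
  subT-subT σ τ (fun k ts) = cong (fun k) (subTs-subTs σ τ ts)

  subTs-subTs : ∀ σ τ → subTs σ ∘ subTs τ ≗ subTs (subT σ ∘ τ)
  subTs-subTs σ τ []       = refl
  subTs-subTs σ τ (t ∷ ts) = cong₂ _∷_ (subT-subT σ τ t) (subTs-subTs σ τ ts)

mutual
  subT-var : subT var ≗ (λ t → t)
  subT-var (var x)    = refl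
  subT-var (fun k ts) = cong (fun k) (subTs-var ts)

  subTs-var : subTs var ≗ (λ ts → ts)
  subTs-var []       = refl
  subTs-var (t ∷ ts) = cong₂ _∷_ (subT-var t) (subTs-var ts)

liftSub-cong : ∀ {σ τ} → σ ≗ τ → liftSub σ ≗ liftSub τ
liftSub-cong σ≗τ zero    = refl
liftSub-cong σ≗τ (suc x) = cong (renT suc) (σ≗τ x)

liftSub-var : liftSub var ≗ var
liftSub-var zero    = refl
liftSub-var (suc x) = refl

liftSub-ren : ∀ ρ → liftSub (var ∘ ρ) ≗ var ∘ liftRen ρ
liftSub-ren ρ zero    = refl
liftSub-ren ρ (suc x) = refl

renT-suc-subT : ∀ σ t → renT suc (subT σ t) ≡ subT (renT suc ∘ σ) t
renT-suc-subT σ t = begin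
  renT suc (subT σ t)              ≡⟨ renT≡subT suc (subT σ t) ⟩
  subT (var ∘ suc) (subT σ t)      ≡⟨ subT-subT (var ∘ suc) σ t ⟩
  subT (subT (var ∘ suc) ∘ σ) t    ≡⟨ subT-cong (sym ∘ renT≡subT suc ∘ σ) t ⟩
  subT (renT suc ∘ σ) t            ∎
  where open ≡-Reasoning

liftSub-subT : ∀ σ τ → liftSub (subT σ ∘ τ) ≗ subT (liftSub σ) ∘ liftSub τ
liftSub-subT σ τ zero    = refl
liftSub-subT σ τ (suc x) = begin
  renT suc (subT σ (τ x))                     ≡⟨ renT-suc-subT σ (τ x) ⟩
  subT (liftSub σ ∘ suc) (τ x)                ≡⟨ subT-subT (liftSub σ) (var ∘ suc) (τ x) ⟨
  subT (liftSub σ) (subT (var ∘ suc) (τ x))   ≡⟨ cong (subT (liftSub σ)) (renT≡subT suc (τ x)) ⟨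
  subT (liftSub σ) (renT suc (τ x))           ∎
  where open ≡-Reasoning

inst-renT-suc : ∀ t u → subT (inst t) (renT suc u) ≡ u
inst-renT-suc t u = begin
  subT (inst t) (renT suc u)            ≡⟨ cong (subT (inst t)) (renT≡subT suc u) ⟩
  subT (inst t) (subT (var ∘ suc) u)    ≡⟨ subT-subT (inst t) (var ∘ suc) u ⟩
  subT var u                            ≡⟨ subT-var u ⟩
  u                                     ∎
  where open ≡-Reasoning

subA-cong : ∀ {σ τ} → σ ≗ τ → subA σ ≗ subA τ
subA-cong σ≗τ (atom p ts) = cong (atom p) (subTs-cong σ≗τ ts)

renA≡subA : ∀ ρ → renA ρ ≗ subA (var ∘ ρ)
renA≡subA ρ (atom p ts) = cong (atom p) (renTs≡subTs ρ ts)

subA-subA : ∀ σ τ → subA σ ∘ subA τ ≗ subA (subT σ ∘ τ)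
subA-subA σ τ (atom p ts) = cong (atom p) (subTs-subTs σ τ ts)

subA-var : subA var ≗ (λ a → a)
subA-var (atom p ts) = cong (atom p) (subTs-var ts)

module CutAdmissibility (Role : Set) where

  open LMRL Role

  subF-cong : ∀ {σ τ} → σ ≗ τ → subF σ ≗ subF τ
  subF-cong e (at a)        = cong at (subA-cong e a)
  subF-cong e (¬[ f ] A)    = cong ¬[ f ] (subF-cong e A)
  subF-cong e (and U A B)   = cong₂ (and U) (subF-cong e A) (subF-cong e B)
  subF-cong e (imp f U A B) = cong₂ (imp f U) (subF-cong e A) (subF-cong e B)
  subF-cong e (bang U A)    = cong (bang U) (subF-cong e A)
  subF-cong e (all U A)     = cong (all U) (subF-cong (liftSub-cong e) A)

  renF≡subF : ∀ ρ → renF ρ ≗ subF (var ∘ ρ)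
  renF≡subF ρ (at a)        = cong at (renA≡subA ρ a)
  renF≡subF ρ (¬[ f ] A)    = cong ¬[ f ] (renF≡subF ρ A)
  renF≡subF ρ (and U A B)   = cong₂ (and U) (renF≡subF ρ A) (renF≡subF ρ B)
  renF≡subF ρ (imp f U A B) = cong₂ (imp f U) (renF≡subF ρ A) (renF≡subF ρ B)
  renF≡subF ρ (bang U A)    = cong (bang U) (renF≡subF ρ A)
  renF≡subF ρ (all U A)     =
    cong (all U) (trans (renF≡subF (liftRen ρ) A) (subF-cong (sym ∘ liftSub-ren ρ) A))

  subF-subF : ∀ σ τ → subF σ ∘ subF τ ≗ subF (subT σ ∘ τ)
  subF-subF σ τ (at a)        = cong at (subA-subA σ τ a)
  subF-subF σ τ (¬[ f ] A)    = cong ¬[ f ] (subF-subF σ τ A)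
  subF-subF σ τ (and U A B)   = cong₂ (and U) (subF-subF σ τ A) (subF-subF σ τ B)
  subF-subF σ τ (imp f U A B) = cong₂ (imp f U) (subF-subF σ τ A) (subF-subF σ τ B)
  subF-subF σ τ (bang U A)    = cong (bang U) (subF-subF σ τ A)
  subF-subF σ τ (all U A)     =
    cong (all U) (trans (subF-subF (liftSub σ) (liftSub τ) A) (subF-cong (sym ∘ liftSub-subT σ τ) A))

  subF-var : subF var ≗ (λ A → A)
  subF-var (at a)        = cong at (subA-var a)
  subF-var (¬[ f ] A)    = cong ¬[ f ] (subF-var A)
  subF-var (and U A B)   = cong₂ (and U) (subF-var A) (subF-var B)
  subF-var (imp f U A B) = cong₂ (imp f U) (subF-var A) (subF-var B)
  subF-var (bang U A)    = cong (bang U) (subF-var A)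
  subF-var (all U A)     = cong (all U) (trans (subF-cong liftSub-var A) (subF-var A))

  renF-suc-[0≔] : ∀ t A → renF suc A [0≔ t ] ≡ A
  renF-suc-[0≔] t A = begin
    subF (inst t) (renF suc A)            ≡⟨ cong (subF (inst t)) (renF≡subF suc A) ⟩
    subF (inst t) (subF (var ∘ suc) A)    ≡⟨ subF-subF (inst t) (var ∘ suc) A ⟩
    subF var A                            ≡⟨ subF-var A ⟩
    A                                     ∎
    where open ≡-Reasoning

  subF-[0≔] : ∀ σ t A → subF σ (A [0≔ t ]) ≡ subF (liftSub σ) A [0≔ subT σ t ]
  subF-[0≔] σ t A = begin
    subF σ (subF (inst t) A)                          ≡⟨ subF-subF σ (inst t) A ⟩
    subF (subT σ ∘ inst t) A                          ≡⟨ subF-cong inst-liftSub A ⟩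
    subF (subT (inst (subT σ t)) ∘ liftSub σ) A       ≡⟨ subF-subF (inst (subT σ t)) (liftSub σ) A ⟨
    subF (inst (subT σ t)) (subF (liftSub σ) A)       ∎
    where
    open ≡-Reasoning
    inst-liftSub : subT σ ∘ inst t ≗ subT (inst (subT σ t)) ∘ liftSub σ
    inst-liftSub zero    = refl
    inst-liftSub (suc x) = sym (inst-renT-suc (subT σ t) (σ x))

  renF-[0≔] : ∀ ρ t A → renF ρ (A [0≔ t ]) ≡ renF (liftRen ρ) A [0≔ renT ρ t ]
  renF-[0≔] ρ t A = begin
    renF ρ (A [0≔ t ])                                  ≡⟨ renF≡subF ρ (A [0≔ t ]) ⟩
    subF (var ∘ ρ) (A [0≔ t ])                          ≡⟨ subF-[0≔] (var ∘ ρ) t A ⟩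
    subF (liftSub (var ∘ ρ)) A [0≔ subT (var ∘ ρ) t ]   ≡⟨ cong₂ _[0≔_] lifted (sym (renT≡subT ρ t)) ⟩
    renF (liftRen ρ) A [0≔ renT ρ t ]                   ∎
    where
    open ≡-Reasoning
    lifted : subF (liftSub (var ∘ ρ)) A ≡ renF (liftRen ρ) A
    lifted = trans (subF-cong (liftSub-ren ρ) A) (sym (renF≡subF (liftRen ρ) A))

  liftSub-renF-suc : ∀ σ A → subF (liftSub σ) (renF suc A) ≡ renF suc (subF σ A)
  liftSub-renF-suc σ A = begin
    subF (liftSub σ) (renF suc A)             ≡⟨ cong (subF (liftSub σ)) (renF≡subF suc A) ⟩
    subF (liftSub σ) (subF (var ∘ suc) A)     ≡⟨ subF-subF (liftSub σ) (var ∘ suc) A ⟩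
    subF (renT suc ∘ σ) A                     ≡⟨ subF-cong (renT≡subT suc ∘ σ) A ⟩
    subF (subT (var ∘ suc) ∘ σ) A             ≡⟨ subF-subF (var ∘ suc) σ A ⟨
    subF (var ∘ suc) (subF σ A)               ≡⟨ renF≡subF suc (subF σ A) ⟨
    renF suc (subF σ A)                       ∎
    where open ≡-Reasoning

  size : Formula → ℕ
  size (at a)        = zero
  size (¬[ f ] A)    = suc (size A)
  size (and U A B)   = suc (size A + size B)
  size (imp f U A B) = suc (size A + size B)
  size (bang U A)    = suc (size A)
  size (all U A)     = suc (size A)

  size-subF : ∀ σ A → size (subF σ A) ≡ size A
  size-subF σ (at a)        = refl
  size-subF σ (¬[ f ] A)    = cong suc (size-subF σ A)
  size-subF σ (and U A B)   = cong suc (cong₂ _+_ (size-subF σ A) (size-subF σ B))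
  size-subF σ (imp f U A B) = cong suc (cong₂ _+_ (size-subF σ A) (size-subF σ B))
  size-subF σ (bang U A)    = cong suc (size-subF σ A)
  size-subF σ (all U A)     = cong suc (size-subF (liftSub σ) A)

  size-renF : ∀ ρ A → size (renF ρ A) ≡ size A
  size-renF ρ A = trans (cong size (renF≡subF ρ A)) (size-subF (var ∘ ρ) A)

  ≐-refl : ∀ {R} → R ≐ R
  ≐-refl = (λ r x → x) , (λ r x → x)

  ≐-sym : ∀ {R S} → R ≐ S → S ≐ R
  ≐-sym (R⊆S , S⊆R) = S⊆R , R⊆S

  ≐-trans : ∀ {R S T} → R ≐ S → S ≐ T → R ≐ T
  ≐-trans (R⊆S , S⊆R) (S⊆T , T⊆S) = (λ r → S⊆T r ∘ R⊆S r) , (λ r → S⊆R r ∘ T⊆S r)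

  ≐-setoid : Setoid (lsuc 0ℓ) 0ℓ
  ≐-setoid = record
    { Carrier = Subset ; _≈_ = _≐_
    ; isEquivalence = record { refl = ≐-refl ; sym = ≐-sym ; trans = ≐-trans } }

  module ≐ = PermutationSetoid ≐-setoid
  open ≐ using () renaming (_↭_ to _↭≐_)

  ≃-setoid : Setoid (lsuc 0ℓ) (lsuc 0ℓ)
  ≃-setoid = record
    { Carrier = IFormula ; _≈_ = _≃_
    ; isEquivalence = record
      { refl  = ≐-refl , refl
      ; sym   = λ (e , q) → ≐-sym e , sym q
      ; trans = λ (e , q) (e′ , q′) → ≐-trans e e′ , trans q q′ } }

  open Setoid ≃-setoid using () renaming (refl to ≃-refl; sym to ≃-sym)
  open import Data.List.Relation.Binary.Equality.Setoid ≃-setoid using (≋-refl; ++⁺)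
  module ~ = PermutationSetoid ≃-setoid
  open ~ using (prep; swap; ↭-refl; ↭-sym; ↭-trans; ↭-prep; ↭-swap; ↭-reflexive)
    renaming (_↭_ to _~_; refl to ≋⇒~)
  open PermutationSetoidProperties ≃-setoid
    using (↭-split; ↭-shift; shift; ++⁺ˡ; ++⁺ʳ; ++-comm; drop-∷; All-resp-↭; ∈-resp-↭;
           xs↭ys⇒|xs|≡|ys|; ++-commutativeMonoid)
    renaming (++⁺ to ++⁺-~)

  -- The suffix Θ is where prep and swap park the heads they move.
  ⊢-resp-~-++ : ∀ {Γ Δ} → Γ ~ Δ → ∀ Θ → ⊢ Γ ++ Θ → ⊢ Δ ++ Θ
  ⊢-resp-~-++ (≋⇒~ Γ≋Δ) Θ d = ext (++⁺ Γ≋Δ ≋-refl) d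
  ⊢-resp-~-++ (prep {xs} {ys} {x} {y} x≃y p) Θ d =
    ext (x≃y ∷ ≋-refl)
      (exchange (↭ₚ.shift x ys Θ)
        (⊢-resp-~-++ p (x ∷ Θ) (exchange (↭ₚ.↭-sym (↭ₚ.shift x xs Θ)) d)))
  ⊢-resp-~-++ (swap {xs} {ys} {x} {y} {x′} {y′} x≃x′ y≃y′ p) Θ d =
    ext (y≃y′ ∷ x≃x′ ∷ ≋-refl)
      (exchange (shift₂ y x ys)
        (⊢-resp-~-++ p (y ∷ x ∷ Θ)
          (exchange (↭ₚ.trans (↭ₚ.swap x y ↭ₚ.refl) (↭ₚ.↭-sym (shift₂ y x xs))) d)))
    where
    shift₂ : ∀ u v zs → zs ++ u ∷ v ∷ Θ ↭ₚ.↭ u ∷ v ∷ zs ++ Θ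
    shift₂ u v zs = ↭ₚ.trans (↭ₚ.shift u zs (v ∷ Θ)) (↭ₚ.prep u (↭ₚ.shift v zs Θ))
  ⊢-resp-~-++ (~.trans p q) Θ d = ⊢-resp-~-++ q Θ (⊢-resp-~-++ p Θ d)

  ⊢-resp-~ : ∀ {Γ Δ} → Γ ~ Δ → ⊢ Γ → ⊢ Δ
  ⊢-resp-~ {Γ} {Δ} p d =
    subst ⊢_ (++-identityʳ Δ) (⊢-resp-~-++ p [] (subst ⊢_ (sym (++-identityʳ Γ)) d))

  ↭ₚ⇒~ : ∀ {Γ Δ} → Γ ↭ₚ.↭ Δ → Γ ~ Δ
  ↭ₚ⇒~ ↭ₚ.refl        = ↭-refl
  ↭ₚ⇒~ (↭ₚ.prep x p)  = ↭-prep x (↭ₚ⇒~ p)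
  ↭ₚ⇒~ (↭ₚ.swap x y p) = ↭-swap x y (↭ₚ⇒~ p)
  ↭ₚ⇒~ (↭ₚ.trans p q) = ↭-trans (↭ₚ⇒~ p) (↭ₚ⇒~ q)

  []≁∷ : ∀ {x Γ} → ¬ ([] ~ x ∷ Γ)
  []≁∷ p with xs↭ys⇒|xs|≡|ys| p
  ... | ()

  data HeadView (y : IFormula) (Θ : Sequent) (v : IFormula) (Γ : Sequent) : Set₁ where
    same  : y ≃ v → Θ ~ Γ → HeadView y Θ v Γ
    other : ∀ Γ′ → Θ ~ v ∷ Γ′ → Γ ~ y ∷ Γ′ → HeadView y Θ v Γ

  head-view : ∀ {y v Θ Γ} → y ∷ Θ ~ v ∷ Γ → HeadView y Θ v Γ
  head-view {v = v} {Γ = Γ} p with ↭-split v [] Γ p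
  ... | [] , qs , y≃v ∷ Θ≋qs , qs~Γ = same y≃v (↭-trans (≋⇒~ Θ≋qs) qs~Γ)
  ... | _ ∷ ps , qs , y≃y′ ∷ Θ≋ , ps++qs~Γ =
    other (ps ++ qs) (↭-trans (≋⇒~ Θ≋) (↭-shift ps qs))
      (↭-trans (↭-sym ps++qs~Γ) (prep (≃-sym y≃y′) ↭-refl))

  data AppendView (v : IFormula) (Θa Θb Γ : Sequent) : Set₁ where
    left  : ∀ Θa′ → Θa ~ v ∷ Θa′ → Θa′ ++ Θb ~ Γ → AppendView v Θa Θb Γ
    right : ∀ Θb′ → Θb ~ v ∷ Θb′ → Θa ++ Θb′ ~ Γ → AppendView v Θa Θb Γ

  append-view : ∀ {v} Θa {Θb Γ} → Θa ++ Θb ~ v ∷ Γ → AppendView v Θa Θb Γ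
  append-view {v} Θa {Θb} p with Any.++⁻ Θa (∈-resp-↭ (↭-sym p) (here ≃-refl))
  ... | inj₁ v∈Θa with Membership.∈-∃++ ≃-setoid v∈Θa
  ...   | ys , zs , _ , v≃ , Θa≋ = left (ys ++ zs) Θa~ (drop-∷ (↭-trans (↭-sym (++⁺ʳ Θb Θa~)) p))
    where
    Θa~ : Θa ~ v ∷ ys ++ zs
    Θa~ = ↭-trans (≋⇒~ Θa≋) (shift (≃-sym v≃) ys zs)
  append-view {v} Θa {Θb} p | inj₂ v∈Θb with Membership.∈-∃++ ≃-setoid v∈Θb
  ...   | ys , zs , _ , v≃ , Θb≋ =
    right (ys ++ zs) Θb~ (drop-∷ (↭-trans (↭-sym (↭-trans (++⁺ˡ Θa Θb~) (↭-shift Θa (ys ++ zs)))) p))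
    where
    Θb~ : Θb ~ v ∷ ys ++ zs
    Θb~ = ↭-trans (≋⇒~ Θb≋) (shift (≃-sym v≃) ys zs)

  Disjoint : Subset → Subset → Set
  Disjoint R S = ∀ r → R r → S r → ⊥

  Disjoint-sym : ∀ {R S} → Disjoint R S → Disjoint S R
  Disjoint-sym R#S r s∈S r∈R = R#S r r∈R s∈S

  IsPartition : List Subset → Set₁
  IsPartition Rs = (∀ r → Any (λ S → S r) Rs) × AllPairs Disjoint Rs

  lookup⇒AllPairs : ∀ Rs → (∀ i j → i ≢ j → Disjoint (lookup Rs i) (lookup Rs j)) → AllPairs Disjoint Rs
  lookup⇒AllPairs []       _  = []
  lookup⇒AllPairs (R ∷ Rs) Rs# =
    head# Rs (λ j → Rs# fzero (fsuc j) (λ ()))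
      ∷ lookup⇒AllPairs Rs (λ i j i≢j → Rs# (fsuc i) (fsuc j) (i≢j ∘ fsuc-injective))
    where
    fsuc-injective : ∀ {n} {i j : Fin n} → fsuc i ≡ fsuc j → i ≡ j
    fsuc-injective refl = refl
    head# : ∀ Ss → (∀ j → Disjoint R (lookup Ss j)) → All (Disjoint R) Ss
    head# []       _   = []
    head# (S ∷ Ss) R#Ss = R#Ss fzero ∷ head# Ss (R#Ss ∘ fsuc)

  AllPairs⇒lookup : ∀ {Rs} → AllPairs Disjoint Rs → ∀ i j → i ≢ j → Disjoint (lookup Rs i) (lookup Rs j)
  AllPairs⇒lookup (R#Rs ∷ Rs#) fzero    fzero    i≢j = ⊥-elim (i≢j refl)
  AllPairs⇒lookup (R#Rs ∷ Rs#) fzero    (fsuc j) i≢j = All.lookup R#Rs (∈-lookup j)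
  AllPairs⇒lookup (R#Rs ∷ Rs#) (fsuc i) fzero    i≢j = Disjoint-sym (All.lookup R#Rs (∈-lookup i))
  AllPairs⇒lookup (R#Rs ∷ Rs#) (fsuc i) (fsuc j) i≢j = AllPairs⇒lookup Rs# i j (i≢j ∘ cong fsuc)

  Partition⇒IsPartition : ∀ {Rs} → Partition Rs → IsPartition Rs
  Partition⇒IsPartition {Rs} (cover , disjoint) =
    (λ r → lose (∈-lookup (proj₁ (cover r))) (proj₂ (cover r))) , lookup⇒AllPairs Rs disjoint

  IsPartition⇒Partition : ∀ {Rs} → IsPartition Rs → Partition Rs
  IsPartition⇒Partition (cover , disjoint) =
    (λ r → Any.index (cover r) , Any.lookup-index (cover r)) , AllPairs⇒lookup disjoint

  IsPartition-resp-↭ : ∀ {Rs Ss} → Rs ↭≐ Ss → IsPartition Rs → IsPartition Ss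
  IsPartition-resp-↭ p (cover , disjoint) =
    (λ r → PermutationSetoidProperties.Any-resp-↭ ≐-setoid (λ R≐S → proj₁ R≐S r) p (cover r)) ,
    PermutationSetoidProperties.AllPairs-resp-↭ ≐-setoid Disjoint-sym
      ((λ S≐T R#S r r∈R r∈T → R#S r r∈R (proj₂ S≐T r r∈T)) , (λ S≐T S#R r → S#R r ∘ proj₂ S≐T r))
      p disjoint

  ∩-IsPartition : ∀ {R₁ R₂ Ss Ts} → Disjoint (∁ R₁) (∁ R₂) →
    IsPartition (R₁ ∷ Ss) → IsPartition (R₂ ∷ Ts) → IsPartition (R₁ ∩ R₂ ∷ Ss ++ Ts)
  ∩-IsPartition {R₁} {R₂} {Ss} {Ts} co (cover₁ , R₁#Ss ∷ Ss#) (cover₂ , R₂#Ts ∷ Ts#) =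
    cover ,
    All.++⁺ (All.map (λ R₁#S r → R₁#S r ∘ proj₁) R₁#Ss) (All.map (λ R₂#T r → R₂#T r ∘ proj₂) R₂#Ts)
      ∷ AllPairs.++⁺ Ss# Ts# Ss#Ts
    where
    cover : ∀ r → Any (λ S → S r) (R₁ ∩ R₂ ∷ Ss ++ Ts)
    cover r with cover₁ r | cover₂ r
    ... | there r∈Ss | _          = there (Any.++⁺ˡ r∈Ss)
    ... | here r∈R₁  | here r∈R₂  = here (r∈R₁ , r∈R₂)
    ... | here _     | there r∈Ts = there (Any.++⁺ʳ Ss r∈Ts)
    Ss#Ts : All (λ S → All (Disjoint S) Ts) Ss
    Ss#Ts = All.map (λ R₁#S → All.map (λ R₂#T r r∈S r∈T →
              co r (λ r∈R₁ → R₁#S r r∈R₁ r∈S) (λ r∈R₂ → R₂#T r r∈R₂ r∈T)) R₂#Ts) R₁#Ss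

  ∈U-resp-≐ : ∀ U {R S} → R ≐ S → (U ∈U) R → (U ∈U) S
  ∈U-resp-≐ U R≐S = upw U (proj₁ R≐S)

  ∉U-resp-≐ : ∀ U {R S} → R ≐ S → ¬ (U ∈U) R → ¬ (U ∈U) S
  ∉U-resp-≐ U R≐S R∉U = R∉U ∘ ∈U-resp-≐ U (≐-sym R≐S)

  ∉U-∩ˡ : ∀ U {R S} → ¬ (U ∈U) R → ¬ (U ∈U) (R ∩ S)
  ∉U-∩ˡ U R∉U = R∉U ∘ upw U (λ r → proj₁)

  ∉U-∩ʳ : ∀ U {R S} → ¬ (U ∈U) S → ¬ (U ∈U) (R ∩ S)
  ∉U-∩ʳ U S∉U = S∉U ∘ upw U (λ r → proj₂)

  -- The ultrafilter contains ∁ R and ∁ S, hence their (empty) intersection, hence S.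
  ∉U⇒∈U : ∀ U {R S} → Disjoint (∁ R) (∁ S) → ¬ (U ∈U) R → (U ∈U) S
  ∉U⇒∈U U {R} {S} co R∉U with ultra U R | ultra U S
  ... | inj₁ R∈U | _        = ⊥-elim (R∉U R∈U)
  ... | inj₂ _   | inj₁ S∈U = S∈U
  ... | inj₂ ∁R∈U | inj₂ ∁S∈U = upw U (λ r (r∉R , r∉S) → ⊥-elim (co r r∉R r∉S)) (inter U ∁R∈U ∁S∈U)

  ¬-both-∉U : ∀ U {R S} → Disjoint (∁ R) (∁ S) → ¬ (U ∈U) R → ¬ (U ∈U) S → ⊥
  ¬-both-∉U U co R∉U S∉U = S∉U (∉U⇒∈U U co R∉U)

  ∩-comm : ∀ {R S} → (R ∩ S) ≐ (S ∩ R)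
  ∩-comm = (λ r (x , y) → y , x) , (λ r (x , y) → y , x)

  preimage-resp-≐ : ∀ f {R S} → R ≐ S → (f ⁻¹[ R ]) ≐ (f ⁻¹[ S ])
  preimage-resp-≐ f (R⊆S , S⊆R) = (λ r → R⊆S (f r)) , (λ r → S⊆R (f r))

  WhyNot-resp-≃ : ∀ {x y} → x ≃ y → WhyNot x → WhyNot y
  WhyNot-resp-≃ {[ R ] A} {[ S ] B} (R≐S , refl) (U , C , A≡!C , R∉U) = U , C , A≡!C , ∉U-resp-≐ U R≐S R∉U

  atoms : Atom → List Subset → Sequent
  atoms a = map (λ S → [ S ] at a)

  atoms-~-∷ : ∀ {a R A Γ} Rs → atoms a Rs ~ [ R ] A ∷ Γ →
    A ≡ at a × Σ (List Subset) λ Ss → Rs ↭≐ R ∷ Ss × Γ ~ atoms a Ss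
  atoms-~-∷ [] p = ⊥-elim ([]≁∷ p)
  atoms-~-∷ (S ∷ Rs) p with head-view p
  ... | same (S≐R , at≡A) p′ = sym at≡A , Rs , ≐.prep S≐R ≐.↭-refl , ↭-sym p′
  ... | other Γ′ p₁ p₂ with atoms-~-∷ Rs p₁
  ...   | A≡a , Ss , Rs↭ , Γ′~ =
    A≡a , S ∷ Ss ,
    ≐.↭-trans (≐.↭-prep S Rs↭) (≐.↭-swap S _ ≐.↭-refl) ,
    ↭-trans p₂ (↭-prep _ Γ′~)

  subI : (ℕ → Term) → IFormula → IFormula
  subI σ ([ R ] A) = [ R ] subF σ A

  renI : (ℕ → ℕ) → IFormula → IFormula
  renI ρ ([ R ] A) = [ R ] renF ρ A

  map-subI-↑ : ∀ σ Γ → map (subI (liftSub σ)) (↑ Γ) ≡ ↑ (map (subI σ) Γ)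
  map-subI-↑ σ []             = refl
  map-subI-↑ σ ([ R ] A ∷ Γ) = cong₂ _∷_ (cong ([ R ]_) (liftSub-renF-suc σ A)) (map-subI-↑ σ Γ)

  map-subI-ren : ∀ ρ Γ → map (subI (var ∘ ρ)) Γ ≡ map (renI ρ) Γ
  map-subI-ren ρ []             = refl
  map-subI-ren ρ ([ R ] A ∷ Γ) = cong₂ _∷_ (cong ([ R ]_) (sym (renF≡subF ρ A))) (map-subI-ren ρ Γ)

  map-inst-↑ : ∀ t Γ → map (subI (inst t)) (↑ Γ) ≡ Γ
  map-inst-↑ t []             = refl
  map-inst-↑ t ([ R ] A ∷ Γ) = cong₂ _∷_ (cong ([ R ]_) (renF-suc-[0≔] t A)) (map-inst-↑ t Γ)

  ↑-++ : ∀ Γ Δ → ↑ (Γ ++ Δ) ≡ ↑ Γ ++ ↑ Δ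
  ↑-++ = map-++ _

  All-WhyNot-subI : ∀ σ {Γ} → All WhyNot Γ → All WhyNot (map (subI σ) Γ)
  All-WhyNot-subI σ []                                   = []
  All-WhyNot-subI σ {[ R ] A ∷ Γ} ((U , B , refl , R∉U) ∷ ws) =
    (U , subF σ B , refl , R∉U) ∷ All-WhyNot-subI σ ws

  All-WhyNot-↑ : ∀ {Γ} → All WhyNot Γ → All WhyNot (↑ Γ)
  All-WhyNot-↑ {Γ} ws = subst (All WhyNot) (map-subI-ren suc Γ) (All-WhyNot-subI (var ∘ suc) ws)

  ≋-subI : ∀ σ {Γ Δ} → Pointwise _≃_ Γ Δ → Pointwise _≃_ (map (subI σ) Γ) (map (subI σ) Δ)
  ≋-subI σ []                                         = []
  ≋-subI σ {[ R ] A ∷ Γ} {[ S ] B ∷ Δ} ((R≐S , A≡B) ∷ p) = (R≐S , cong (subF σ) A≡B) ∷ ≋-subI σ p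

  ↑-resp-~ : ∀ {Γ Δ} → Γ ~ Δ → ↑ Γ ~ ↑ Δ
  ↑-resp-~ = PermutationSetoidProperties.map⁺ ≃-setoid ≃-setoid
    (λ { {[ R ] A} {[ S ] B} (R≐S , A≡B) → R≐S , cong (renF suc) A≡B })

  ⊢-subI : ∀ σ {Γ} → ⊢ Γ → ⊢ map (subI σ) Γ
  ⊢-subI σ (id a R Rs P)    = subst ⊢_ (map-∘ (R ∷ Rs)) (id (subA σ a) R Rs P)
  ⊢-subI σ (neg d)          = neg (⊢-subI σ d)
  ⊢-subI σ (imp-neg R∉U d)  = imp-neg R∉U (⊢-subI σ d)
  ⊢-subI σ (imp-pos {Γ₁} {Γ₂} R∈U d e) =
    subst (λ Δ → ⊢ _ ∷ Δ) (sym (map-++ (subI σ) Γ₁ Γ₂)) (imp-pos R∈U (⊢-subI σ d) (⊢-subI σ e))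
  ⊢-subI σ (and-neg₁ R∉U d)      = and-neg₁ R∉U (⊢-subI σ d)
  ⊢-subI σ (and-neg₂ R∉U d)      = and-neg₂ R∉U (⊢-subI σ d)
  ⊢-subI σ (and-pos R∈U d e)     = and-pos R∈U (⊢-subI σ d) (⊢-subI σ e)
  ⊢-subI σ (bang-pos ws R∈U d)   = bang-pos (All-WhyNot-subI σ ws) R∈U (⊢-subI σ d)
  ⊢-subI σ (bang-weaken R∉U d)   = bang-weaken R∉U (⊢-subI σ d)
  ⊢-subI σ (bang-derelict R∉U d) = bang-derelict R∉U (⊢-subI σ d)
  ⊢-subI σ (bang-contract R∉U d) = bang-contract R∉U (⊢-subI σ d)
  ⊢-subI σ (all-neg {Γ} {R} {U} {A} t R∉U d) =
    all-neg (subT σ t) R∉U (subst (λ B → ⊢ [ R ] B ∷ map (subI σ) Γ) (subF-[0≔] σ t A) (⊢-subI σ d))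
  ⊢-subI σ (all-pos {Γ} {R} {U} {A} R∈U d) =
    all-pos R∈U (subst (λ Δ → ⊢ [ R ] subF (liftSub σ) A ∷ Δ) (map-subI-↑ σ Γ) (⊢-subI (liftSub σ) d))
  ⊢-subI σ (exchange p d) = exchange (↭ₚ.map⁺ (subI σ) p) (⊢-subI σ d)
  ⊢-subI σ (ext p d)      = ext (≋-subI σ p) (⊢-subI σ d)

  ⊢-↑ : ∀ {Γ} → ⊢ Γ → ⊢ ↑ Γ
  ⊢-↑ {Γ} d = subst ⊢_ (map-subI-ren suc Γ) (⊢-subI (var ∘ suc) d)

  ⊢-↑-under-∀ : ∀ {R A Γ} → ⊢ [ R ] A ∷ ↑ Γ → ⊢ [ R ] renF (liftRen suc) A ∷ ↑ (↑ Γ)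
  ⊢-↑-under-∀ {R} {A} {Γ} d =
    subst₂ (λ B Δ → ⊢ [ R ] B ∷ Δ)
      (trans (subF-cong (liftSub-ren suc) A) (sym (renF≡subF (liftRen suc) A)))
      (trans (map-subI-↑ (var ∘ suc) Γ) (cong ↑ (map-subI-ren suc Γ)))
      (⊢-subI (liftSub (var ∘ suc)) d)

  ⊢-[0≔] : ∀ {R A Γ} t → ⊢ [ R ] A ∷ ↑ Γ → ⊢ [ R ] (A [0≔ t ]) ∷ Γ
  ⊢-[0≔] {R} {A} {Γ} t d = subst (λ Δ → ⊢ [ R ] (A [0≔ t ]) ∷ Δ) (map-inst-↑ t Γ) (⊢-subI (inst t) d)

  weaken-? : ∀ {Θ Γ} → All WhyNot Θ → ⊢ Γ → ⊢ Θ ++ Γ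
  weaken-? []                              d = d
  weaken-? {[ R ] A ∷ Θ} ((U , B , refl , R∉U) ∷ ws) d = bang-weaken R∉U (weaken-? ws d)

  contract-? : ∀ {Θ Γ} → All WhyNot Θ → ⊢ Θ ++ Θ ++ Γ → ⊢ Θ ++ Γ
  contract-? []                                  d = d
  contract-? {[ R ] A ∷ Θ} {Γ} ((U , B , refl , R∉U) ∷ ws) d =
    ⊢-resp-~ (↭-shift Θ Γ) (contract-? {Θ} {[ R ] A ∷ Γ} ws
      (⊢-resp-~ (↭-sym (↭-trans (++⁺ˡ Θ (↭-shift Θ Γ)) (↭-shift Θ (Θ ++ Γ))))
        (bang-contract R∉U (⊢-resp-~ (↭-prep _ (↭-shift Θ (Θ ++ Γ))) d))))

  open import Algebra.Solver.CommutativeMonoid ++-commutativeMonoid using (prove; _⊕_; Expr)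
    renaming (var to ⟨_⟩)

  v₀ v₁ v₂ v₃ v₄ v₅ : Expr 6
  v₀ = ⟨ fzero ⟩
  v₁ = ⟨ fsuc fzero ⟩
  v₂ = ⟨ fsuc (fsuc fzero) ⟩
  v₃ = ⟨ fsuc (fsuc (fsuc fzero)) ⟩
  v₄ = ⟨ fsuc (fsuc (fsuc (fsuc fzero))) ⟩
  v₅ = ⟨ fsuc (fsuc (fsuc (fsuc (fsuc fzero)))) ⟩

  ∷-~-++ : ∀ L {P Θ Γ} → Θ ~ L ++ Γ → P ∷ Θ ~ L ++ P ∷ Γ
  ∷-~-++ L {P} {Θ} {Γ} p = ↭-trans (↭-prep P p) (↭-sym (↭-shift L Γ))

  ∷∷-~-++ : ∀ L {P Q Θ Γ} → Θ ~ L ++ Γ → P ∷ Q ∷ Θ ~ L ++ P ∷ Q ∷ Γ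
  ∷∷-~-++ L = ∷-~-++ L ∘ ∷-~-++ L

  ⊢-to-front : ∀ L Θ {P} → ⊢ L ++ P ∷ Θ → ⊢ P ∷ L ++ Θ
  ⊢-to-front L Θ = ⊢-resp-~ (↭-shift L Θ)

  -- Applying a rule, whose principal formula y belongs to Γ, beneath the prefix L.
  module _ (L Γ′ E : Sequent) {y Γ} (Γ~ : Γ ~ y ∷ Γ′) where

    from-front : ⊢ y ∷ L ++ Γ′ ++ E → ⊢ L ++ Γ ++ E
    from-front = ⊢-resp-~ (↭-trans (↭-sym (↭-shift L (Γ′ ++ E))) (++⁺ˡ L (++⁺ʳ E (↭-sym Γ~))))

    under₁ : ∀ {P} → (⊢ P ∷ L ++ Γ′ ++ E → ⊢ y ∷ L ++ Γ′ ++ E) →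
      ⊢ L ++ P ∷ Γ′ ++ E → ⊢ L ++ Γ ++ E
    under₁ rule = from-front ∘ rule ∘ ⊢-to-front L (Γ′ ++ E)

    under₁₁ : ∀ {P Q} → (⊢ P ∷ L ++ Γ′ ++ E → ⊢ Q ∷ L ++ Γ′ ++ E → ⊢ y ∷ L ++ Γ′ ++ E) →
      ⊢ L ++ P ∷ Γ′ ++ E → ⊢ L ++ Q ∷ Γ′ ++ E → ⊢ L ++ Γ ++ E
    under₁₁ rule d e = from-front (rule (⊢-to-front L (Γ′ ++ E) d) (⊢-to-front L (Γ′ ++ E) e))

    under₂ : ∀ {P Q} → (⊢ P ∷ Q ∷ L ++ Γ′ ++ E → ⊢ y ∷ L ++ Γ′ ++ E) →
      ⊢ L ++ P ∷ Q ∷ Γ′ ++ E → ⊢ L ++ Γ ++ E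
    under₂ {P} {Q} rule =
      from-front ∘ rule ∘ ⊢-resp-~ (↭-trans (↭-shift L (Q ∷ Γ′ ++ E)) (↭-prep P (↭-shift L (Γ′ ++ E))))

  imp-pos-left : ∀ {X Γa Γb Γ E R f U A B} → (U ∈U) R →
    ⊢ X ∷ [ f ⁻¹[ R ] ] A ∷ Γa ++ E → ⊢ [ R ] B ∷ Γb → Γa ++ Γb ~ Γ →
    ⊢ [ R ] imp f U A B ∷ X ∷ Γ ++ E
  imp-pos-left {X} {Γa} {Γb} {Γ} {E} R∈U d e Γ~ =
    ⊢-resp-~ (↭-prep _ (↭-prep X regroup)) (imp-pos R∈U (⊢-resp-~ (↭-swap X _ ↭-refl) d) e)
    where
    regroup : (Γa ++ E) ++ Γb ~ Γ ++ E
    regroup = ↭-trans (prove 6 ((v₀ ⊕ v₂) ⊕ v₁) ((v₀ ⊕ v₁) ⊕ v₂) (Γa ∷ Γb ∷ E ∷ [] ∷ [] ∷ [] ∷ []))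
                      (++⁺ʳ E Γ~)

  imp-pos-right : ∀ {X Γa Γb Γ E R f U A B} → (U ∈U) R →
    ⊢ [ f ⁻¹[ R ] ] A ∷ Γa → ⊢ X ∷ [ R ] B ∷ Γb ++ E → Γa ++ Γb ~ Γ →
    ⊢ [ R ] imp f U A B ∷ X ∷ Γ ++ E
  imp-pos-right {X} {Γa} {Γb} {Γ} {E} R∈U d e Γ~ =
    ⊢-resp-~ (↭-prep _ regroup) (imp-pos R∈U d (⊢-resp-~ (↭-swap X _ ↭-refl) e))
    where
    regroup : Γa ++ X ∷ Γb ++ E ~ X ∷ Γ ++ E
    regroup = ↭-trans (prove 6 (v₁ ⊕ (v₀ ⊕ (v₂ ⊕ v₃))) (v₀ ⊕ ((v₁ ⊕ v₂) ⊕ v₃))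
                               ((X ∷ []) ∷ Γa ∷ Γb ∷ E ∷ [] ∷ [] ∷ []))
                      (↭-prep X (++⁺ʳ E Γ~))

  -- Derivations whose last rule introduces the distinguished formula [R]A, context Γ up to ~.
  data Principal (R : Subset) (Γ : Sequent) : Formula → Set₁ where
    id            : ∀ {a} Ss → IsPartition (R ∷ Ss) → Γ ~ atoms a Ss → Principal R Γ (at a)
    neg           : ∀ {f A} → ⊢ [ f ⁻¹[ R ] ] A ∷ Γ → Principal R Γ (¬[ f ] A)
    imp-neg       : ∀ {f U A B} → ¬ (U ∈U) R → ⊢ [ f ⁻¹[ R ] ] A ∷ [ R ] B ∷ Γ →
                    Principal R Γ (imp f U A B)
    imp-pos       : ∀ {f U A B} Γ₁ Γ₂ → (U ∈U) R → ⊢ [ f ⁻¹[ R ] ] A ∷ Γ₁ → ⊢ [ R ] B ∷ Γ₂ →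
                    Γ ~ Γ₁ ++ Γ₂ → Principal R Γ (imp f U A B)
    and-neg₁      : ∀ {U A B} → ¬ (U ∈U) R → ⊢ [ R ] A ∷ Γ → Principal R Γ (and U A B)
    and-neg₂      : ∀ {U A B} → ¬ (U ∈U) R → ⊢ [ R ] B ∷ Γ → Principal R Γ (and U A B)
    and-pos       : ∀ {U A B} → (U ∈U) R → ⊢ [ R ] A ∷ Γ → ⊢ [ R ] B ∷ Γ → Principal R Γ (and U A B)
    bang-pos      : ∀ {U A} → All WhyNot Γ → (U ∈U) R → ⊢ [ R ] A ∷ Γ → Principal R Γ (bang U A)
    bang-weaken   : ∀ {U A} → ¬ (U ∈U) R → ⊢ Γ → Principal R Γ (bang U A)
    bang-derelict : ∀ {U A} → ¬ (U ∈U) R → ⊢ [ R ] A ∷ Γ → Principal R Γ (bang U A)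
    bang-contract : ∀ {U A} → ¬ (U ∈U) R → ⊢ [ R ] bang U A ∷ [ R ] bang U A ∷ Γ →
                    Principal R Γ (bang U A)
    all-neg       : ∀ {U A} t → ¬ (U ∈U) R → ⊢ [ R ] (A [0≔ t ]) ∷ Γ → Principal R Γ (all U A)
    all-pos       : ∀ {U A} → (U ∈U) R → ⊢ [ R ] A ∷ ↑ Γ → Principal R Γ (all U A)

  principal⇒⊢ : ∀ {R Γ A} → Principal R Γ A → ⊢ [ R ] A ∷ Γ
  principal⇒⊢ {R} (id {a} Ss P Γ~) = ⊢-resp-~ (↭-prep _ (↭-sym Γ~)) (id a R Ss (IsPartition⇒Partition P))
  principal⇒⊢ (neg d)              = neg d
  principal⇒⊢ (imp-neg R∉U d)      = imp-neg R∉U d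
  principal⇒⊢ (imp-pos _ _ R∈U d e Γ~) = ⊢-resp-~ (↭-prep _ (↭-sym Γ~)) (imp-pos R∈U d e)
  principal⇒⊢ (and-neg₁ R∉U d)      = and-neg₁ R∉U d
  principal⇒⊢ (and-neg₂ R∉U d)      = and-neg₂ R∉U d
  principal⇒⊢ (and-pos R∈U d e)     = and-pos R∈U d e
  principal⇒⊢ (bang-pos ws R∈U d)   = bang-pos ws R∈U d
  principal⇒⊢ (bang-weaken R∉U d)   = bang-weaken R∉U d
  principal⇒⊢ (bang-derelict R∉U d) = bang-derelict R∉U d
  principal⇒⊢ (bang-contract R∉U d) = bang-contract R∉U d
  principal⇒⊢ (all-neg t R∉U d)     = all-neg t R∉U d
  principal⇒⊢ (all-pos R∈U d)       = all-pos R∈U d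

  Principal-resp : ∀ {R R′ Γ Γ′ A} → R′ ≐ R → Γ′ ~ Γ → Principal R′ Γ′ A → Principal R Γ A
  Principal-resp e p (id Ss P Γ′~) =
    id Ss (IsPartition-resp-↭ (≐.prep e ≐.↭-refl) P) (↭-trans (↭-sym p) Γ′~)
  Principal-resp {R′ = R′} e p (neg {f} d) = neg (⊢-resp-~ (prep (preimage-resp-≐ f e , refl) p) d)
  Principal-resp e p (imp-neg {f} {U} R′∉U d) =
    imp-neg (∉U-resp-≐ U e R′∉U) (⊢-resp-~ (prep (preimage-resp-≐ f e , refl) (prep (e , refl) p)) d)
  Principal-resp e p (imp-pos {f} {U} Γ₁ Γ₂ R′∈U d₁ d₂ Γ′~) =
    imp-pos Γ₁ Γ₂ (∈U-resp-≐ U e R′∈U) (⊢-resp-~ (prep (preimage-resp-≐ f e , refl) ↭-refl) d₁)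
      (⊢-resp-~ (prep (e , refl) ↭-refl) d₂) (↭-trans (↭-sym p) Γ′~)
  Principal-resp e p (and-neg₁ {U} R′∉U d) = and-neg₁ (∉U-resp-≐ U e R′∉U) (⊢-resp-~ (prep (e , refl) p) d)
  Principal-resp e p (and-neg₂ {U} R′∉U d) = and-neg₂ (∉U-resp-≐ U e R′∉U) (⊢-resp-~ (prep (e , refl) p) d)
  Principal-resp e p (and-pos {U} R′∈U d₁ d₂) =
    and-pos (∈U-resp-≐ U e R′∈U) (⊢-resp-~ (prep (e , refl) p) d₁) (⊢-resp-~ (prep (e , refl) p) d₂)
  Principal-resp e p (bang-pos {U} ws R′∈U d) =
    bang-pos (All-resp-↭ WhyNot-resp-≃ p ws) (∈U-resp-≐ U e R′∈U) (⊢-resp-~ (prep (e , refl) p) d)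
  Principal-resp e p (bang-weaken {U} R′∉U d)   = bang-weaken (∉U-resp-≐ U e R′∉U) (⊢-resp-~ p d)
  Principal-resp e p (bang-derelict {U} R′∉U d) =
    bang-derelict (∉U-resp-≐ U e R′∉U) (⊢-resp-~ (prep (e , refl) p) d)
  Principal-resp e p (bang-contract {U} R′∉U d) =
    bang-contract (∉U-resp-≐ U e R′∉U) (⊢-resp-~ (prep (e , refl) (prep (e , refl) p)) d)
  Principal-resp e p (all-neg {U} t R′∉U d) = all-neg t (∉U-resp-≐ U e R′∉U) (⊢-resp-~ (prep (e , refl) p) d)
  Principal-resp e p (all-pos {U} R′∈U d) =
    all-pos (∈U-resp-≐ U e R′∈U) (⊢-resp-~ (prep (e , refl) (↑-resp-~ p)) d)

  ↑-atoms : ∀ a Ss → ↑ (atoms a Ss) ≡ atoms (renA suc a) Ss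
  ↑-atoms a []       = refl
  ↑-atoms a (S ∷ Ss) = cong ([ S ] at (renA suc a) ∷_) (↑-atoms a Ss)

  Principal-↑ : ∀ {R Γ A} → Principal R Γ A → Principal R (↑ Γ) (renF suc A)
  Principal-↑ (id {a} Ss P Γ~)          = id Ss P (↭-trans (↑-resp-~ Γ~) (↭-reflexive (↑-atoms a Ss)))
  Principal-↑ (neg d)                   = neg (⊢-↑ d)
  Principal-↑ (imp-neg R∉U d)           = imp-neg R∉U (⊢-↑ d)
  Principal-↑ (imp-pos Γ₁ Γ₂ R∈U d e Γ~) =
    imp-pos (↑ Γ₁) (↑ Γ₂) R∈U (⊢-↑ d) (⊢-↑ e) (↭-trans (↑-resp-~ Γ~) (↭-reflexive (↑-++ Γ₁ Γ₂)))
  Principal-↑ (and-neg₁ R∉U d)          = and-neg₁ R∉U (⊢-↑ d)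
  Principal-↑ (and-neg₂ R∉U d)          = and-neg₂ R∉U (⊢-↑ d)
  Principal-↑ (and-pos R∈U d e)         = and-pos R∈U (⊢-↑ d) (⊢-↑ e)
  Principal-↑ (bang-pos ws R∈U d)       = bang-pos (All-WhyNot-↑ ws) R∈U (⊢-↑ d)
  Principal-↑ (bang-weaken R∉U d)       = bang-weaken R∉U (⊢-↑ d)
  Principal-↑ (bang-derelict R∉U d)     = bang-derelict R∉U (⊢-↑ d)
  Principal-↑ (bang-contract R∉U d)     = bang-contract R∉U (⊢-↑ d)
  Principal-↑ {R} {Γ} (all-neg {A = A} t R∉U d) =
    all-neg (renT suc t) R∉U (subst (λ B → ⊢ [ R ] B ∷ ↑ Γ) (renF-[0≔] suc t A) (⊢-↑ d))
  Principal-↑ (all-pos R∈U d)           = all-pos R∈U (⊢-↑-under-∀ d)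

  promotion? : ∀ {R Γ U B} → Principal R Γ (bang U B) →
    (All WhyNot Γ × (U ∈U) R × ⊢ [ R ] B ∷ Γ) ⊎ ¬ (U ∈U) R
  promotion? (bang-pos ws R∈U d)   = inj₁ (ws , R∈U , d)
  promotion? (bang-weaken R∉U _)   = inj₂ R∉U
  promotion? (bang-derelict R∉U _) = inj₂ R∉U
  promotion? (bang-contract R∉U _) = inj₂ R∉U

  ∩-++-comm : ∀ {R₁ R₂ A} Γ₁ Γ₂ → ⊢ [ R₂ ∩ R₁ ] A ∷ Γ₂ ++ Γ₁ → ⊢ [ R₁ ∩ R₂ ] A ∷ Γ₁ ++ Γ₂
  ∩-++-comm Γ₁ Γ₂ = ⊢-resp-~ (prep (∩-comm , refl) (++-comm Γ₂ Γ₁))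

  CutBelow : ℕ → Set₁
  CutBelow n = ∀ {A R₁ R₂ Γ₁ Γ₂} → size A < n → Disjoint (∁ R₁) (∁ R₂) →
    ⊢ [ R₁ ] A ∷ Γ₁ → ⊢ [ R₂ ] A ∷ Γ₂ → ⊢ [ R₁ ∩ R₂ ] A ∷ Γ₁ ++ Γ₂

  replicate-+ : ∀ {A : Set₁} m n (x : A) → replicate (m + n) x ≡ replicate m x ++ replicate n x
  replicate-+ zero    n x = refl
  replicate-+ (suc m) n x = cong (x ∷_) (replicate-+ m n x)

  data CopiesView (X y : IFormula) (Θ : Sequent) (k : ℕ) (Γ : Sequent) : Set₁ where
    copy  : ∀ {k′} → k ≡ suc k′ → y ≃ X → Θ ~ replicate k′ X ++ Γ → CopiesView X y Θ k Γ
    other : ∀ Γ′ → Θ ~ replicate k X ++ Γ′ → Γ ~ y ∷ Γ′ → CopiesView X y Θ k Γ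

  copies-view : ∀ {X y Θ Γ} k → y ∷ Θ ~ replicate k X ++ Γ → CopiesView X y Θ k Γ
  copies-view {Θ = Θ} zero p = other Θ ↭-refl (↭-sym p)
  copies-view {X} (suc k) p with head-view p
  ... | same y≃X Θ~ = copy refl y≃X Θ~
  ... | other Γ″ Θ~ Γ~ with copies-view k (↭-sym Γ~)
  ...   | copy refl y≃X Γ″~ = copy refl y≃X (↭-trans Θ~ (↭-prep X Γ″~))
  ...   | other Γ‴ Γ″~ Γ~′  = other Γ‴ (↭-trans Θ~ (↭-prep X Γ″~)) Γ~′

  data CopiesSplit (X : IFormula) (k : ℕ) (Θa Θb Γ : Sequent) : Set₁ where
    split : ∀ ka kb Γa Γb → ka + kb ≡ k → Θa ~ replicate ka X ++ Γa → Θb ~ replicate kb X ++ Γb →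
            Γ ~ Γa ++ Γb → CopiesSplit X k Θa Θb Γ

  split-copies : ∀ {X} k Θa Θb {Γ} → Θa ++ Θb ~ replicate k X ++ Γ → CopiesSplit X k Θa Θb Γ
  split-copies zero Θa Θb p = split 0 0 Θa Θb refl ↭-refl ↭-refl (↭-sym p)
  split-copies {X} (suc k) Θa Θb p with append-view Θa p
  ... | left Θa′ Θa~ Θ′~ with split-copies k Θa′ Θb Θ′~
  ...   | split ka kb Γa Γb refl Θa′~ Θb~ Γ~ =
    split (suc ka) kb Γa Γb refl (↭-trans Θa~ (↭-prep X Θa′~)) Θb~ Γ~
  split-copies {X} (suc k) Θa Θb p | right Θb′ Θb~ Θ′~ with split-copies k Θa Θb′ Θ′~
  ...   | split ka kb Γa Γb refl Θa~ Θb′~ Γ~ =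
    split ka (suc kb) Γa Γb (+-suc ka kb) Θa~ (↭-trans Θb~ (↭-prep X Θb′~)) Γ~

  -- Cutting a promotion of [R₂]B against k copies of the dual ?-formula (k grows under contraction);
  -- the ?-context Γ₂ of the promotion absorbs the duplications and erasures this causes.
  module Multicut (n : ℕ) (cut< : CutBelow n) {R₁ R₂ : Subset} (co : Disjoint (∁ R₁) (∁ R₂))
                  (U : Ultrafilter) (R₁∉U : ¬ (U ∈U) R₁) where

    Xs X′s : ℕ → Formula → Sequent
    Xs  k B = replicate k ([ R₁ ] bang U B)
    X′s k B = replicate k ([ R₁ ∩ R₂ ] bang U B)

    R₁∩R₂∉U : ¬ (U ∈U) (R₁ ∩ R₂)
    R₁∩R₂∉U = ∉U-∩ˡ U R₁∉U

    multicut-imp-pos : ∀ {B Γ₁ Γ₂ Γa Γb R f U′ C D} ka kb → (U′ ∈U) R →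
      ⊢ X′s ka B ++ ([ f ⁻¹[ R ] ] C ∷ Γa) ++ Γ₂ → ⊢ X′s kb B ++ ([ R ] D ∷ Γb) ++ Γ₂ →
      Γ₁ ~ [ R ] imp f U′ C D ∷ Γa ++ Γb → All WhyNot Γ₂ → ⊢ X′s (ka + kb) B ++ Γ₁ ++ Γ₂
    multicut-imp-pos {B} {Γ₁} {Γ₂} {Γa} {Γb} {R} {f} {U′} {C} {D} ka kb R∈U d e Γ₁~ ws =
      ⊢-resp-~ regroup (contract-? ws (⊢-resp-~ Γ₂-to-front
        (imp-pos R∈U (⊢-to-front (X′s ka B) (Γa ++ Γ₂) d) (⊢-to-front (X′s kb B) (Γb ++ Γ₂) e))))
      where
      y = [ R ] imp f U′ C D
      env = (y ∷ []) ∷ X′s ka B ∷ Γa ∷ Γ₂ ∷ X′s kb B ∷ Γb ∷ []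
      Γ₂-to-front : y ∷ (X′s ka B ++ Γa ++ Γ₂) ++ (X′s kb B ++ Γb ++ Γ₂) ~
                    Γ₂ ++ Γ₂ ++ y ∷ (X′s ka B ++ X′s kb B) ++ Γa ++ Γb
      Γ₂-to-front = prove 6 (v₀ ⊕ ((v₁ ⊕ (v₂ ⊕ v₃)) ⊕ (v₄ ⊕ (v₅ ⊕ v₃))))
                            (v₃ ⊕ (v₃ ⊕ (v₀ ⊕ ((v₁ ⊕ v₄) ⊕ (v₂ ⊕ v₅))))) env
      regroup : Γ₂ ++ y ∷ (X′s ka B ++ X′s kb B) ++ Γa ++ Γb ~ X′s (ka + kb) B ++ Γ₁ ++ Γ₂
      regroup = ↭-trans (prove 6 (v₃ ⊕ (v₀ ⊕ ((v₁ ⊕ v₄) ⊕ (v₂ ⊕ v₅))))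
                                 ((v₁ ⊕ v₄) ⊕ ((v₀ ⊕ (v₂ ⊕ v₅)) ⊕ v₃)) env)
                        (++⁺-~ (↭-reflexive (sym (replicate-+ ka kb _))) (++⁺ʳ Γ₂ (↭-sym Γ₁~)))

    multicut-derelict : ∀ {B Γ₁ Γ₂} k → size B < n → All WhyNot Γ₂ → ⊢ [ R₂ ] B ∷ Γ₂ →
      ⊢ X′s k B ++ ([ R₁ ] B ∷ Γ₁) ++ Γ₂ → ⊢ X′s (suc k) B ++ Γ₁ ++ Γ₂
    multicut-derelict {B} {Γ₁} {Γ₂} k sz ws pr d =
      ⊢-resp-~ regroup (contract-? ws (⊢-resp-~ Γ₂-to-front
        (bang-derelict R₁∩R₂∉U (cut< sz co (⊢-to-front (X′s k B) (Γ₁ ++ Γ₂) d) pr))))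
      where
      x = [ R₁ ∩ R₂ ] bang U B
      env = (x ∷ []) ∷ X′s k B ∷ Γ₁ ∷ Γ₂ ∷ [] ∷ [] ∷ []
      Γ₂-to-front : x ∷ (X′s k B ++ Γ₁ ++ Γ₂) ++ Γ₂ ~ Γ₂ ++ Γ₂ ++ x ∷ X′s k B ++ Γ₁
      Γ₂-to-front = prove 6 (v₀ ⊕ ((v₁ ⊕ (v₂ ⊕ v₃)) ⊕ v₃)) (v₃ ⊕ (v₃ ⊕ (v₀ ⊕ (v₁ ⊕ v₂)))) env
      regroup : Γ₂ ++ x ∷ X′s k B ++ Γ₁ ~ x ∷ X′s k B ++ Γ₁ ++ Γ₂
      regroup = prove 6 (v₃ ⊕ (v₀ ⊕ (v₁ ⊕ v₂))) (v₀ ⊕ (v₁ ⊕ (v₂ ⊕ v₃))) env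

    multicut : ∀ {B Γ₁ Γ₂ Δ} k → size B < n → All WhyNot Γ₂ → ⊢ [ R₂ ] B ∷ Γ₂ →
      ⊢ Δ → Δ ~ Xs k B ++ Γ₁ → ⊢ X′s k B ++ Γ₁ ++ Γ₂
    multicut {Γ₁ = Γ₁} {Γ₂} zero _ ws _ (id a R Rs P) p =
      ⊢-resp-~ (++-comm Γ₂ Γ₁) (weaken-? ws (⊢-resp-~ p (id a R Rs P)))
    multicut (suc k) _ _ _ (id a R Rs P) p with atoms-~-∷ (R ∷ Rs) p
    ... | () , _
    multicut {B} {Γ₂ = Γ₂} k sz ws pr (neg d) p with copies-view k p
    ... | copy _ (_ , ()) _
    ... | other Γ′ p₁ p₂ = under₁ (X′s k B) Γ′ Γ₂ p₂ neg (multicut k sz ws pr d (∷-~-++ (Xs k B) p₁))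
    multicut {B} {Γ₂ = Γ₂} k sz ws pr (imp-neg R∉U d) p with copies-view k p
    ... | copy _ (_ , ()) _
    ... | other Γ′ p₁ p₂ =
      under₂ (X′s k B) Γ′ Γ₂ p₂ (imp-neg R∉U) (multicut k sz ws pr d (∷∷-~-++ (Xs k B) p₁))
    multicut k sz ws pr (imp-pos {Θa} {Θb} R∈U d e) p with copies-view k p
    ... | copy _ (_ , ()) _
    ... | other Γ′ p₁ p₂ with split-copies k Θa Θb p₁
    ...   | split ka kb Γa Γb refl Θa~ Θb~ Γ′~ = multicut-imp-pos ka kb R∈U
      (multicut ka sz ws pr d (∷-~-++ (Xs ka _) Θa~)) (multicut kb sz ws pr e (∷-~-++ (Xs kb _) Θb~))
      (↭-trans p₂ (↭-prep _ Γ′~)) ws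
    multicut {B} {Γ₂ = Γ₂} k sz ws pr (and-neg₁ R∉U d) p with copies-view k p
    ... | copy _ (_ , ()) _
    ... | other Γ′ p₁ p₂ = under₁ (X′s k B) Γ′ Γ₂ p₂ (and-neg₁ R∉U) (multicut k sz ws pr d (∷-~-++ (Xs k B) p₁))
    multicut {B} {Γ₂ = Γ₂} k sz ws pr (and-neg₂ R∉U d) p with copies-view k p
    ... | copy _ (_ , ()) _
    ... | other Γ′ p₁ p₂ = under₁ (X′s k B) Γ′ Γ₂ p₂ (and-neg₂ R∉U) (multicut k sz ws pr d (∷-~-++ (Xs k B) p₁))
    multicut {B} {Γ₂ = Γ₂} k sz ws pr (and-pos R∈U d e) p with copies-view k p
    ... | copy _ (_ , ()) _
    ... | other Γ′ p₁ p₂ = under₁₁ (X′s k B) Γ′ Γ₂ p₂ (and-pos R∈U)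
      (multicut k sz ws pr d (∷-~-++ (Xs k B) p₁)) (multicut k sz ws pr e (∷-~-++ (Xs k B) p₁))
    multicut {B} {Γ₂ = Γ₂} k sz ws pr (bang-pos ws′ R∈U d) p with copies-view k p
    ... | copy _ (R≐R₁ , refl) _ = ⊥-elim (R₁∉U (∈U-resp-≐ U R≐R₁ R∈U))
    ... | other Γ′ p₁ p₂ = under₁ (X′s k B) Γ′ Γ₂ p₂ (bang-pos ws″ R∈U) (multicut k sz ws pr d (∷-~-++ (Xs k B) p₁))
      where
      ws″ : All WhyNot (X′s k B ++ Γ′ ++ Γ₂)
      ws″ = All.++⁺ (All.replicate⁺ k (U , B , refl , R₁∩R₂∉U))
                    (All.++⁺ (All.++⁻ʳ (Xs k B) (All-resp-↭ WhyNot-resp-≃ p₁ ws′)) ws)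
    multicut {B} {Γ₂ = Γ₂} k sz ws pr (bang-weaken R∉U d) p with copies-view k p
    ... | copy {k′} refl (_ , refl) q = bang-weaken R₁∩R₂∉U (multicut k′ sz ws pr d q)
    ... | other Γ′ p₁ p₂ = from-front (X′s k B) Γ′ Γ₂ p₂ (bang-weaken R∉U (multicut k sz ws pr d p₁))
    multicut {B} {Γ₂ = Γ₂} k sz ws pr (bang-derelict R∉U d) p with copies-view k p
    ... | copy {k′} refl (R≐R₁ , refl) q = multicut-derelict k′ sz ws pr
      (multicut k′ sz ws pr d (↭-trans (prep (R≐R₁ , refl) q) (↭-sym (↭-shift (Xs k′ B) _))))
    ... | other Γ′ p₁ p₂ =
      under₁ (X′s k B) Γ′ Γ₂ p₂ (bang-derelict R∉U) (multicut k sz ws pr d (∷-~-++ (Xs k B) p₁))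
    multicut {B} {Γ₂ = Γ₂} k sz ws pr (bang-contract R∉U d) p with copies-view k p
    ... | copy {k′} refl x≃ q =
      bang-contract R₁∩R₂∉U (multicut (suc (suc k′)) sz ws pr d (prep x≃ (prep x≃ q)))
    ... | other Γ′ p₁ p₂ =
      under₂ (X′s k B) Γ′ Γ₂ p₂ (bang-contract R∉U) (multicut k sz ws pr d (∷∷-~-++ (Xs k B) p₁))
    multicut {B} {Γ₂ = Γ₂} k sz ws pr (all-neg t R∉U d) p with copies-view k p
    ... | copy _ (_ , ()) _
    ... | other Γ′ p₁ p₂ = under₁ (X′s k B) Γ′ Γ₂ p₂ (all-neg t R∉U) (multicut k sz ws pr d (∷-~-++ (Xs k B) p₁))
    multicut {B} {Γ₂ = Γ₂} k sz ws pr (all-pos {Θ} {R} {U′} {C} R∈U d) p with copies-view k p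
    ... | copy _ (_ , ()) _
    ... | other Γ′ p₁ p₂ =
      from-front (X′s k B) Γ′ Γ₂ p₂ (all-pos R∈U (subst (λ Δ → ⊢ [ R ] C ∷ Δ) shifted r))
      where
      B↑ = renF suc B
      ↑Xs : ↑ (Xs k B ++ Γ′) ≡ Xs k B↑ ++ ↑ Γ′
      ↑Xs = trans (↑-++ (Xs k B) Γ′) (cong (_++ ↑ Γ′) (map-replicate _ k _))
      shifted : X′s k B↑ ++ ↑ Γ′ ++ ↑ Γ₂ ≡ ↑ (X′s k B ++ Γ′ ++ Γ₂)
      shifted = sym (trans (↑-++ (X′s k B) (Γ′ ++ Γ₂)) (cong₂ _++_ (map-replicate _ k _) (↑-++ Γ′ Γ₂)))
      r : ⊢ [ R ] C ∷ X′s k B↑ ++ ↑ Γ′ ++ ↑ Γ₂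
      r = ⊢-to-front (X′s k B↑) (↑ Γ′ ++ ↑ Γ₂)
            (multicut k (subst (_< n) (sym (size-renF suc B)) sz) (All-WhyNot-↑ ws) (⊢-↑ pr) d
              (∷-~-++ (Xs k B↑) (↭-trans (↑-resp-~ p₁) (↭-reflexive ↑Xs))))
    multicut k sz ws pr (exchange q d) p = multicut k sz ws pr d (↭-trans (↭ₚ⇒~ q) p)
    multicut k sz ws pr (ext q d) p      = multicut k sz ws pr d (↭-trans (≋⇒~ q) p)

  module PrincipalCuts (n : ℕ) (cut< : CutBelow n) {R₁ R₂ : Subset} (co : Disjoint (∁ R₁) (∁ R₂)) where

    <ˡ : ∀ {a b} → suc (a + b) ≤ n → a < n
    <ˡ {a} {b} = <-≤-trans (s≤s (m≤m+n a b))

    <ʳ : ∀ {a b} → suc (a + b) ≤ n → b < n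
    <ʳ {a} {b} = <-≤-trans (s≤s (m≤n+m b a))

    PrincipalCut : Formula → Set₁
    PrincipalCut A = ∀ {Γ₁ Γ₂} → Principal R₁ Γ₁ A → Principal R₂ Γ₂ A → ⊢ [ R₁ ∩ R₂ ] A ∷ Γ₁ ++ Γ₂

    cut-at : ∀ {a} → PrincipalCut (at a)
    cut-at {a} (id Ss P₁ Γ₁~) (id Ts P₂ Γ₂~) =
      ⊢-resp-~ (↭-prep _ (↭-trans (↭-reflexive (map-++ _ Ss Ts)) (++⁺-~ (↭-sym Γ₁~) (↭-sym Γ₂~))))
        (id a (R₁ ∩ R₂) (Ss ++ Ts) (IsPartition⇒Partition (∩-IsPartition co P₁ P₂)))

    cut-neg : ∀ {f A} → size A < n → PrincipalCut (¬[ f ] A)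
    cut-neg {f} sz (neg d₁) (neg d₂) = neg (cut< sz (co ∘ f) d₁ d₂)

    cut-imp : ∀ {f U A B} → size (imp f U A B) ≤ n → PrincipalCut (imp f U A B)
    cut-imp {f} {U} sz {Γ₁} {Γ₂} (imp-pos Γa Γb R₁∈U a₁ b₁ Γ₁~) (imp-pos Γc Γd R₂∈U a₂ b₂ Γ₂~) =
      ⊢-resp-~ (↭-prep _ regroup)
        (imp-pos (inter U R₁∈U R₂∈U) (cut< (<ˡ sz) (co ∘ f) a₁ a₂) (cut< (<ʳ sz) co b₁ b₂))
      where
      regroup : (Γa ++ Γc) ++ Γb ++ Γd ~ Γ₁ ++ Γ₂
      regroup = ↭-trans (prove 6 ((v₀ ⊕ v₁) ⊕ (v₂ ⊕ v₃)) ((v₀ ⊕ v₂) ⊕ (v₁ ⊕ v₃))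
                                 (Γa ∷ Γc ∷ Γb ∷ Γd ∷ [] ∷ [] ∷ []))
                        (++⁺-~ (↭-sym Γ₁~) (↭-sym Γ₂~))
    cut-imp {f} {U} {A} {B} sz {Γ₁} {Γ₂} (imp-pos Γa Γb _ a₁ b₁ Γ₁~) (imp-neg R₂∉U d₂) =
      imp-neg (∉U-∩ʳ U R₂∉U) (⊢-resp-~ (↭-prep _ regroup) (cut< (<ˡ sz) (co ∘ f) a₁ cutB))
      where
      B′ = [ R₁ ∩ R₂ ] B
      cutB : ⊢ [ f ⁻¹[ R₂ ] ] A ∷ B′ ∷ Γb ++ Γ₂
      cutB = ⊢-resp-~ (↭-shift (B′ ∷ Γb) Γ₂) (cut< (<ʳ sz) co b₁ (⊢-resp-~ (↭-swap _ _ ↭-refl) d₂))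
      regroup : Γa ++ B′ ∷ Γb ++ Γ₂ ~ B′ ∷ Γ₁ ++ Γ₂
      regroup = ↭-trans (prove 6 (v₁ ⊕ (v₀ ⊕ (v₂ ⊕ v₃))) (v₀ ⊕ ((v₁ ⊕ v₂) ⊕ v₃))
                                 ((B′ ∷ []) ∷ Γa ∷ Γb ∷ Γ₂ ∷ [] ∷ [] ∷ []))
                        (↭-prep B′ (++⁺ʳ Γ₂ (↭-sym Γ₁~)))
    cut-imp {f} {U} {A} {B} sz {Γ₁} {Γ₂} (imp-neg R₁∉U d₁) (imp-pos Γc Γd _ a₂ b₂ Γ₂~) =
      imp-neg (∉U-∩ˡ U R₁∉U) (⊢-resp-~ (↭-prep _ (↭-prep B′ regroup)) (cut< (<ˡ sz) (co ∘ f) cutB a₂))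
      where
      B′ = [ R₁ ∩ R₂ ] B
      cutB : ⊢ [ f ⁻¹[ R₁ ] ] A ∷ B′ ∷ Γ₁ ++ Γd
      cutB = ⊢-resp-~ (↭-swap _ _ ↭-refl) (cut< (<ʳ sz) co (⊢-resp-~ (↭-swap _ _ ↭-refl) d₁) b₂)
      regroup : (Γ₁ ++ Γd) ++ Γc ~ Γ₁ ++ Γ₂
      regroup = ↭-trans (prove 6 ((v₀ ⊕ v₁) ⊕ v₂) (v₀ ⊕ (v₂ ⊕ v₁)) (Γ₁ ∷ Γd ∷ Γc ∷ [] ∷ [] ∷ [] ∷ []))
                        (++⁺ˡ Γ₁ (↭-sym Γ₂~))
    cut-imp {U = U} _ (imp-neg R₁∉U _) (imp-neg R₂∉U _) = ⊥-elim (¬-both-∉U U co R₁∉U R₂∉U)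

    cut-and : ∀ {U A B} → size (and U A B) ≤ n → PrincipalCut (and U A B)
    cut-and {U} sz (and-pos R₁∈U a₁ b₁) (and-pos R₂∈U a₂ b₂) =
      and-pos (inter U R₁∈U R₂∈U) (cut< (<ˡ sz) co a₁ a₂) (cut< (<ʳ sz) co b₁ b₂)
    cut-and {U} sz (and-pos _ a₁ _) (and-neg₁ R₂∉U a₂) = and-neg₁ (∉U-∩ʳ U R₂∉U) (cut< (<ˡ sz) co a₁ a₂)
    cut-and {U} sz (and-pos _ _ b₁) (and-neg₂ R₂∉U b₂) = and-neg₂ (∉U-∩ʳ U R₂∉U) (cut< (<ʳ sz) co b₁ b₂)
    cut-and {U} sz (and-neg₁ R₁∉U a₁) (and-pos _ a₂ _) = and-neg₁ (∉U-∩ˡ U R₁∉U) (cut< (<ˡ sz) co a₁ a₂)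
    cut-and {U} sz (and-neg₂ R₁∉U b₁) (and-pos _ _ b₂) = and-neg₂ (∉U-∩ˡ U R₁∉U) (cut< (<ʳ sz) co b₁ b₂)
    cut-and {U} _ (and-neg₁ R₁∉U _) (and-neg₁ R₂∉U _) = ⊥-elim (¬-both-∉U U co R₁∉U R₂∉U)
    cut-and {U} _ (and-neg₁ R₁∉U _) (and-neg₂ R₂∉U _) = ⊥-elim (¬-both-∉U U co R₁∉U R₂∉U)
    cut-and {U} _ (and-neg₂ R₁∉U _) (and-neg₁ R₂∉U _) = ⊥-elim (¬-both-∉U U co R₁∉U R₂∉U)
    cut-and {U} _ (and-neg₂ R₁∉U _) (and-neg₂ R₂∉U _) = ⊥-elim (¬-both-∉U U co R₁∉U R₂∉U)

    cut-all : ∀ {U A} → size A < n → PrincipalCut (all U A)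
    cut-all {U} {A} sz {Γ₁} {Γ₂} (all-pos R₁∈U d₁) (all-pos R₂∈U d₂) =
      all-pos (inter U R₁∈U R₂∈U)
        (subst (λ Δ → ⊢ [ R₁ ∩ R₂ ] A ∷ Δ) (sym (↑-++ Γ₁ Γ₂)) (cut< sz co d₁ d₂))
    cut-all {U} {A} sz (all-pos _ d₁) (all-neg t R₂∉U d₂) =
      all-neg t (∉U-∩ʳ U R₂∉U) (cut< (subst (_< n) (sym (size-subF (inst t) A)) sz) co (⊢-[0≔] t d₁) d₂)
    cut-all {U} {A} sz (all-neg t R₁∉U d₁) (all-pos _ d₂) =
      all-neg t (∉U-∩ˡ U R₁∉U) (cut< (subst (_< n) (sym (size-subF (inst t) A)) sz) co d₁ (⊢-[0≔] t d₂))
    cut-all {U} _ (all-neg _ R₁∉U _) (all-neg _ R₂∉U _) = ⊥-elim (¬-both-∉U U co R₁∉U R₂∉U)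

    -- co forbids both labels to miss U, so a ?-formula always meets a promotion.
    cut-bang : ∀ {U B} → size B < n → PrincipalCut (bang U B)
    cut-bang {U} sz {Γ₁} {Γ₂} t₁ t₂ with promotion? t₁ | promotion? t₂
    ... | inj₁ (ws₁ , R₁∈U , d₁) | inj₁ (ws₂ , R₂∈U , d₂) =
      bang-pos (All.++⁺ ws₁ ws₂) (inter U R₁∈U R₂∈U) (cut< sz co d₁ d₂)
    ... | inj₁ (ws₁ , _ , d₁) | inj₂ R₂∉U =
      ∩-++-comm Γ₁ Γ₂
        (Multicut.multicut n cut< (Disjoint-sym co) U R₂∉U 1 sz ws₁ d₁ (principal⇒⊢ t₂) ↭-refl)
    ... | inj₂ R₁∉U | inj₁ (ws₂ , _ , d₂) =
      Multicut.multicut n cut< co U R₁∉U 1 sz ws₂ d₂ (principal⇒⊢ t₁) ↭-refl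
    ... | inj₂ R₁∉U | inj₂ R₂∉U = ⊥-elim (¬-both-∉U U co R₁∉U R₂∉U)

    principal-cut : ∀ {A} → size A ≤ n → PrincipalCut A
    principal-cut {at a}         _  = cut-at
    principal-cut {¬[ f ] A}     sz = cut-neg sz
    principal-cut {and U A B}    sz = cut-and sz
    principal-cut {imp f U A B}  sz = cut-imp sz
    principal-cut {bang U B}     sz = cut-bang sz
    principal-cut {all U A}      sz = cut-all sz

  -- Permuting a cut on [R]A upwards through a derivation until [R]A becomes principal.  It stops
  -- early at a ?-formula in the context of a promotion, which cannot be permuted past.
  module Commute (n : ℕ) (R S : Subset) {Other : Formula → Sequent → Set₁}
    (Other-↑ : ∀ {A E} → Other A E → Other (renF suc A) (↑ E))
    (at-principal : ∀ {A Γ E} → size A ≤ n → Principal R Γ A → Other A E → ⊢ [ R ∩ S ] A ∷ Γ ++ E)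
    (at-why-not : ∀ {U B Γ E Δ} → size (bang U B) ≤ n → ¬ (U ∈U) R → ⊢ Δ → Δ ~ [ R ] bang U B ∷ Γ →
                  Other (bang U B) E → ⊢ [ R ∩ S ] bang U B ∷ Γ ++ E)
    where

    source target : Formula → Sequent
    source A = [ R ] A ∷ []
    target A = [ R ∩ S ] A ∷ []

    commute : ∀ {A Γ E Δ} → size A ≤ n → ⊢ Δ → Δ ~ [ R ] A ∷ Γ → Other A E → ⊢ [ R ∩ S ] A ∷ Γ ++ E
    commute sz (id a R₀ Rs P) p o with atoms-~-∷ (R₀ ∷ Rs) p
    ... | refl , Ss , Rs↭ , Γ~ = at-principal sz (id Ss (IsPartition-resp-↭ Rs↭ (Partition⇒IsPartition P)) Γ~) o
    commute {A} {E = E} sz (neg d) p o with head-view p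
    ... | same (R′≐R , refl) p′ = at-principal sz (Principal-resp R′≐R p′ (neg d)) o
    ... | other Γ′ p₁ p₂ = under₁ (target A) Γ′ E p₂ neg (commute sz d (∷-~-++ (source A) p₁) o)
    commute {A} {E = E} sz (imp-neg R′∉U d) p o with head-view p
    ... | same (R′≐R , refl) p′ = at-principal sz (Principal-resp R′≐R p′ (imp-neg R′∉U d)) o
    ... | other Γ′ p₁ p₂ =
      under₂ (target A) Γ′ E p₂ (imp-neg R′∉U) (commute sz d (∷∷-~-++ (source A) p₁) o)
    commute {A} {E = E} sz (imp-pos {Γa} {Γb} R′∈U d e) p o with head-view p
    ... | same (R′≐R , refl) p′ = at-principal sz (Principal-resp R′≐R p′ (imp-pos Γa Γb R′∈U d e ↭-refl)) o
    ... | other Γ′ p₁ p₂ with append-view Γa p₁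
    ...   | left Γa′ Γa~ Γ′~ = from-front (target A) Γ′ E p₂
      (imp-pos-left R′∈U (commute sz d (∷-~-++ (source A) Γa~) o) e Γ′~)
    ...   | right Γb′ Γb~ Γ′~ = from-front (target A) Γ′ E p₂
      (imp-pos-right R′∈U d (commute sz e (∷-~-++ (source A) Γb~) o) Γ′~)
    commute {A} {E = E} sz (and-neg₁ R′∉U d) p o with head-view p
    ... | same (R′≐R , refl) p′ = at-principal sz (Principal-resp R′≐R p′ (and-neg₁ R′∉U d)) o
    ... | other Γ′ p₁ p₂ =
      under₁ (target A) Γ′ E p₂ (and-neg₁ R′∉U) (commute sz d (∷-~-++ (source A) p₁) o)
    commute {A} {E = E} sz (and-neg₂ R′∉U d) p o with head-view p
    ... | same (R′≐R , refl) p′ = at-principal sz (Principal-resp R′≐R p′ (and-neg₂ R′∉U d)) o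
    ... | other Γ′ p₁ p₂ =
      under₁ (target A) Γ′ E p₂ (and-neg₂ R′∉U) (commute sz d (∷-~-++ (source A) p₁) o)
    commute {A} {E = E} sz (and-pos R′∈U d e) p o with head-view p
    ... | same (R′≐R , refl) p′ = at-principal sz (Principal-resp R′≐R p′ (and-pos R′∈U d e)) o
    ... | other Γ′ p₁ p₂ = under₁₁ (target A) Γ′ E p₂ (and-pos R′∈U)
      (commute sz d (∷-~-++ (source A) p₁) o) (commute sz e (∷-~-++ (source A) p₁) o)
    commute sz (bang-pos ws R′∈U d) p o with head-view p
    ... | same (R′≐R , refl) p′ = at-principal sz (Principal-resp R′≐R p′ (bang-pos ws R′∈U d)) o
    ... | other Γ′ p₁ p₂ with All-resp-↭ WhyNot-resp-≃ p₁ ws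
    ...   | (_ , _ , refl , R∉U) ∷ _ = at-why-not sz R∉U (bang-pos ws R′∈U d) p o
    commute {A} {E = E} sz (bang-weaken R′∉U d) p o with head-view p
    ... | same (R′≐R , refl) p′ = at-principal sz (Principal-resp R′≐R p′ (bang-weaken R′∉U d)) o
    ... | other Γ′ p₁ p₂ = from-front (target A) Γ′ E p₂ (bang-weaken R′∉U (commute sz d p₁ o))
    commute {A} {E = E} sz (bang-derelict R′∉U d) p o with head-view p
    ... | same (R′≐R , refl) p′ = at-principal sz (Principal-resp R′≐R p′ (bang-derelict R′∉U d)) o
    ... | other Γ′ p₁ p₂ =
      under₁ (target A) Γ′ E p₂ (bang-derelict R′∉U) (commute sz d (∷-~-++ (source A) p₁) o)
    commute {A} {E = E} sz (bang-contract R′∉U d) p o with head-view p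
    ... | same (R′≐R , refl) p′ = at-principal sz (Principal-resp R′≐R p′ (bang-contract R′∉U d)) o
    ... | other Γ′ p₁ p₂ =
      under₂ (target A) Γ′ E p₂ (bang-contract R′∉U) (commute sz d (∷∷-~-++ (source A) p₁) o)
    commute {A} {E = E} sz (all-neg t R′∉U d) p o with head-view p
    ... | same (R′≐R , refl) p′ = at-principal sz (Principal-resp R′≐R p′ (all-neg t R′∉U d)) o
    ... | other Γ′ p₁ p₂ =
      under₁ (target A) Γ′ E p₂ (all-neg t R′∉U) (commute sz d (∷-~-++ (source A) p₁) o)
    commute {A} {E = E} sz (all-pos {R = R′} {A = C} R′∈U d) p o with head-view p
    ... | same (R′≐R , refl) p′ = at-principal sz (Principal-resp R′≐R p′ (all-pos R′∈U d)) o
    ... | other Γ′ p₁ p₂ =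
      from-front (target A) Γ′ E p₂ (all-pos R′∈U (subst (λ Δ → ⊢ [ R′ ] C ∷ Δ) shifted r))
      where
      A↑ = renF suc A
      shifted : [ R ∩ S ] A↑ ∷ ↑ Γ′ ++ ↑ E ≡ ↑ ([ R ∩ S ] A ∷ Γ′ ++ E)
      shifted = cong ([ R ∩ S ] A↑ ∷_) (sym (↑-++ Γ′ E))
      r : ⊢ [ R′ ] C ∷ [ R ∩ S ] A↑ ∷ ↑ Γ′ ++ ↑ E
      r = ⊢-to-front (target A↑) (↑ Γ′ ++ ↑ E)
            (commute (subst (_≤ n) (sym (size-renF suc A)) sz) d (∷-~-++ (source A↑) (↑-resp-~ p₁))
              (Other-↑ o))
    commute sz (exchange q d) p o = commute sz d (↭-trans (↭ₚ⇒~ q) p) o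
    commute sz (ext q d) p o      = commute sz d (↭-trans (≋⇒~ q) p) o

  -- What is known of the left premise once the right one is being analysed.
  data Analysed (R : Subset) : Formula → Sequent → Set₁ where
    principal : ∀ {A E} → Principal R E A → Analysed R A E
    why-not   : ∀ {U B E Δ} → ¬ (U ∈U) R → ⊢ Δ → Δ ~ [ R ] bang U B ∷ E → Analysed R (bang U B) E

  Analysed-↑ : ∀ {R A E} → Analysed R A E → Analysed R (renF suc A) (↑ E)
  Analysed-↑ (principal t)   = principal (Principal-↑ t)
  Analysed-↑ (why-not R∉U d p) = why-not R∉U (⊢-↑ d) (↑-resp-~ p)

  Derivable : Subset → Formula → Sequent → Set₁
  Derivable R A E = Σ Sequent λ Δ → ⊢ Δ × Δ ~ [ R ] A ∷ E

  Derivable-↑ : ∀ {R A E} → Derivable R A E → Derivable R (renF suc A) (↑ E)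
  Derivable-↑ (Δ , d , p) = ↑ Δ , ⊢-↑ d , ↑-resp-~ p

  module CutStep (n : ℕ) (cut< : CutBelow n) {R₁ R₂ : Subset} (co : Disjoint (∁ R₁) (∁ R₂)) where

    open PrincipalCuts n cut< (Disjoint-sym co) using (principal-cut)
    open Multicut n cut< using (multicut)

    right-principal : ∀ {A Γ E} → size A ≤ n → Principal R₂ Γ A → Analysed R₁ A E → ⊢ [ R₂ ∩ R₁ ] A ∷ Γ ++ E
    right-principal sz t₂ (principal t₁) = principal-cut sz t₂ t₁
    right-principal {Γ = Γ} {E} sz t₂ (why-not {U} R₁∉U d p) with promotion? t₂
    ... | inj₁ (ws , _ , pr) = ∩-++-comm Γ E (multicut co U R₁∉U 1 sz ws pr d p)
    ... | inj₂ R₂∉U = ⊥-elim (¬-both-∉U U co R₁∉U R₂∉U)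

    right-why-not : ∀ {U B Γ E Δ} → size (bang U B) ≤ n → ¬ (U ∈U) R₂ → ⊢ Δ → Δ ~ [ R₂ ] bang U B ∷ Γ →
      Analysed R₁ (bang U B) E → ⊢ [ R₂ ∩ R₁ ] bang U B ∷ Γ ++ E
    right-why-not {U} sz R₂∉U d p (principal t₁) with promotion? t₁
    ... | inj₁ (ws , _ , pr) = multicut (Disjoint-sym co) U R₂∉U 1 sz ws pr d p
    ... | inj₂ R₁∉U = ⊥-elim (¬-both-∉U U co R₁∉U R₂∉U)
    right-why-not {U} _ R₂∉U _ _ (why-not R₁∉U _ _) = ⊥-elim (¬-both-∉U U co R₁∉U R₂∉U)

    open Commute n R₂ R₁ Analysed-↑ right-principal right-why-not
      using () renaming (commute to commute-right)

    left-principal : ∀ {A Γ E} → size A ≤ n → Principal R₁ Γ A → Derivable R₂ A E → ⊢ [ R₁ ∩ R₂ ] A ∷ Γ ++ E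
    left-principal {Γ = Γ} {E} sz t₁ (Δ , d , p) = ∩-++-comm Γ E (commute-right sz d p (principal t₁))

    left-why-not : ∀ {U B Γ E Δ} → size (bang U B) ≤ n → ¬ (U ∈U) R₁ → ⊢ Δ → Δ ~ [ R₁ ] bang U B ∷ Γ →
      Derivable R₂ (bang U B) E → ⊢ [ R₁ ∩ R₂ ] bang U B ∷ Γ ++ E
    left-why-not {Γ = Γ} {E} sz R₁∉U d₁ p₁ (Δ , d₂ , p₂) =
      ∩-++-comm Γ E (commute-right sz d₂ p₂ (why-not R₁∉U d₁ p₁))

    open Commute n R₁ R₂ Derivable-↑ left-principal left-why-not
      using () renaming (commute to commute-left)

    cut : ∀ {A Γ₁ Γ₂} → size A ≤ n → ⊢ [ R₁ ] A ∷ Γ₁ → ⊢ [ R₂ ] A ∷ Γ₂ → ⊢ [ R₁ ∩ R₂ ] A ∷ Γ₁ ++ Γ₂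
    cut sz d₁ d₂ = commute-left sz d₁ ↭-refl (_ , d₂ , ↭-refl)

  cut-below : ∀ n → CutBelow n
  cut-below (suc n) (s≤s sz) co = CutStep.cut n (cut-below n) co sz

lemma10 : (Role : Set) → let open LMRL Role in
    ∀ (R₁ R₂ : Subset) → (∀ (r : Role) → ¬ R₁ r → ¬ R₂ r → ⊥) →
    ∀ (Γ₁ Γ₂ : Sequent) (A : Formula) →
    ⊢ [ R₁ ] A ∷ Γ₁ → ⊢ [ R₂ ] A ∷ Γ₂ → ⊢ [ R₁ ∩ R₂ ] A ∷ Γ₁ ++ Γ₂
lemma10 Role R₁ R₂ co Γ₁ Γ₂ A = cut-below (suc (size A)) ≤-refl co
  where open CutAdmissibility Role
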